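{- Let $r\ge1$ and let $u\neq v$ be vertices of the Kostka polytope $P_r$ labeled $(a,b,\ell)$ and $(a',b',\ell')$ respectively, where $a-b\le a'-b'$. Then $\{u,v\}$ is the vertex set of a face of $P_r$ (i.e. $\mathrm{conv}\{u,v\}$ is an edge) if and only if one of the following holds: (1) $a=b$ and at least one of: (i) $a'=b'$; (ii) $a=b'$; (iii) $a\ge a'$; (iv) $\ell'\ge a$; (2) $a\neq b$ and at least one of: (i) at least two of the three equalities $a=a'$, $b=b'$, $\ell=\ell'$ hold; (ii) $\ell\ge a'$; (iii) $\ell'\ge a$.
   Context: For a positive integer $r$, a partition with at most $r$ parts is written as a non-increasing $r$-tuple of nonnegative integers; $\mathrm{Par}_r(n)$ is the set of those with entries summing to $n$. For $\lambda,\mu\in\mathrm{Par}_r(n)$, $\lambda$ dominates $\mu$ if $\sum_{i=1}^k\lambda_i\ge\sum_{i=1}^k\mu_i$ for all $k\le r$. The $r$-Kostka cone $\mathcal{K}_r\subseteq\mathbb{R}^{2r}$ is the convex hull of all points $(\lambda_1,\dots,\lambda_r,\mu_1,\dots,\mu_r)$ with $\lambda,\mu\in\mathrm{Par}_r(n)$ for some $n$ and $\lambda$ dominating $\mu$. The Kostka polytope $P_r$ is $\mathcal{K}_r\cap\{x:\sum_{i=1}^r(\lambda_i+\mu_i)=1\}$, whose vertices are the intersections with the extremal rays of $\mathcal{K}_r$. It is known that the extremal rays of $\mathcal{K}_r$ are exactly the rays spanned by the vectors $\big((a-\ell)^b,0^{r-b};\,(a-\ell)^\ell,(b-\ell)^{a-\ell},0^{r-a}\big)$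 for integers $0\le\ell<b\le a\le r$, where exponents denote repetition of an entry. A vertex of $P_r$ on the ray of such a vector with $a\neq b$ (so $0\le\ell<b<a\le r$) is labeled $(a,b,\ell)$; when $a=b$ the ray does not depend on $\ell$, and the vertex is labeled $(a,a,a)$. -}

module Defs where

open import Data.Nat as ℕ using (ℕ; zero; suc; _∸_; _<ᵇ_; _≡ᵇ_)
open import Data.Bool using (if_then_else_)
open import Data.Fin using (Fin; toℕ)
import Data.Fin as Fin
open import Data.Integer using (+_)
open import Data.Rational as ℚ using (ℚ; 0ℚ; 1ℚ; _/_)
open import Data.List using (List; []; _∷_)
open import Data.List.Relation.Unary.All using (All)
open import Data.Product using (Σ; _×_; ∃; ∃-syntax; proj₁; proj₂)
open import Data.Sum using (_⊎_)
open import Relation.Binary.PropositionalEquality using (_≡_; _≢_)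
open import Function.Bundles using (_⇔_)

sumℕ : ∀ {r} → (Fin r → ℕ) → ℕ
sumℕ {zero}  f = 0
sumℕ {suc r} f = f Fin.zero ℕ.+ sumℕ (λ i → f (Fin.suc i))

-- prefix sum  f 0 + ... + f (k-1)  (0-indexed; truncated at r)
psum : ∀ {r} → (Fin r → ℕ) → ℕ → ℕ
psum {zero}  f k       = 0
psum {suc r} f zero    = 0
psum {suc r} f (suc k) = f Fin.zero ℕ.+ psum (λ i → f (Fin.suc i)) k

-- a partition with at most r parts: non-increasing r-tuple of naturals
IsPartition : ∀ {r} → (Fin r → ℕ) → Set
IsPartition {r} p = ∀ (i j : Fin r) → toℕ i ℕ.≤ toℕ j → p j ℕ.≤ p i

Dominates : ∀ {r} → (Fin r → ℕ) → (Fin r → ℕ) → Set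
Dominates {r} lam mu = ∀ k → k ℕ.≤ r → psum mu k ℕ.≤ psum lam k

record DomPair (r : ℕ) : Set where
  field
    n    : ℕ
    lam  : Fin r → ℕ
    mu   : Fin r → ℕ
    lamP : IsPartition lam
    muP  : IsPartition mu
    lamN : sumℕ lam ≡ n
    muN  : sumℕ mu ≡ n
    dom  : Dominates lam mu

-- Points of ℚ^{2r} = ℚ^r × ℚ^r  (first block λ-coordinates, second μ)

Point : ℕ → Set
Point r = (Fin r → ℚ) × (Fin r → ℚ)

sumℚ : ∀ {r} → (Fin r → ℚ) → ℚ
sumℚ {zero}  f = 0ℚ
sumℚ {suc r} f = f Fin.zero ℚ.+ sumℚ (λ i → f (Fin.suc i))

_≈_ : ∀ {r} → Point r → Point r → Set
x ≈ y = (∀ i → proj₁ x i ≡ proj₁ y i) × (∀ i → proj₂ x i ≡ proj₂ y i)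

dot : ∀ {r} → Point r → Point r → ℚ
dot c x = sumℚ (λ i → proj₁ c i ℚ.* proj₁ x i) ℚ.+ sumℚ (λ i → proj₂ c i ℚ.* proj₂ x i)

total : ∀ {r} → Point r → ℚ
total x = sumℚ (proj₁ x) ℚ.+ sumℚ (proj₂ x)

ℕ→ℚ : ℕ → ℚ
ℕ→ℚ m = + m / 1

toPoint : ∀ {r} → DomPair r → Point r
toPoint p = (λ i → ℕ→ℚ (DomPair.lam p i)) Data.Product., (λ i → ℕ→ℚ (DomPair.mu p i))

combo : ∀ {r} → List (ℚ × DomPair r) → Point r
combo [] = (λ _ → 0ℚ) Data.Product., (λ _ → 0ℚ)
combo ((c Data.Product., p) ∷ ps) =
  (λ i → c ℚ.* proj₁ (toPoint p) i ℚ.+ proj₁ (combo ps) i) Data.Product.,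
  (λ i → c ℚ.* proj₂ (toPoint p) i ℚ.+ proj₂ (combo ps) i)

coeffSum : ∀ {r} → List (ℚ × DomPair r) → ℚ
coeffSum [] = 0ℚ
coeffSum ((c Data.Product., _) ∷ ps) = c ℚ.+ coeffSum ps

-- the r-Kostka cone: convex hull of all dominance pairs (λ, μ)
InKostkaCone : ∀ {r} → Point r → Set
InKostkaCone {r} x =
  ∃[ ps ] (All (λ q → 0ℚ ℚ.≤ proj₁ q) ps × coeffSum {r} ps ≡ 1ℚ × x ≈ combo ps)

InKostkaPolytope : ∀ {r} → Point r → Set
InKostkaPolytope x = InKostkaCone x × total x ≡ 1ℚ

record Label (r : ℕ) : Set where
  field
    a : ℕ
    b : ℕ
    ℓ : ℕ
    valid : (ℓ ℕ.< b × b ℕ.< a × a ℕ.≤ r) ⊎ (b ≡ a × ℓ ≡ a × 1 ℕ.≤ a × a ℕ.≤ r)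

-- the extremal-ray generator ((a-ℓ)^b,0^{r-b}; (a-ℓ)^ℓ,(b-ℓ)^{a-ℓ},0^{r-a})
rayλ : ∀ {r} → ℕ → ℕ → ℕ → Fin r → ℕ
rayλ a b ℓ i = if toℕ i <ᵇ b then a ∸ ℓ else 0

rayμ : ∀ {r} → ℕ → ℕ → ℕ → Fin r → ℕ
rayμ a b ℓ i = if toℕ i <ᵇ ℓ then a ∸ ℓ else (if toℕ i <ᵇ a then b ∸ ℓ else 0)

-- for a = b the ray does not depend on ℓ (< b); we use ℓ = 0 for it
rayℓ : ∀ {r} → Label r → ℕ
rayℓ L = if Label.a L ≡ᵇ Label.b L then 0 else Label.ℓ L

-- m / s as a rational (s = 0 never occurs for genuine rays)
frac : ℕ → ℕ → ℚ
frac m zero    = 0ℚ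
frac m (suc s) = + m / suc s

vertex : ∀ {r} → Label r → Point r
vertex {r} L =
  (λ i → frac (rayλ a b ℓ i) s) Data.Product., (λ i → frac (rayμ a b ℓ i) s)
  where
    a = Label.a L
    b = Label.b L
    ℓ = rayℓ L
    s = sumℕ (rayλ {r} a b ℓ) ℕ.+ sumℕ (rayμ {r} a b ℓ)

IsEdge : ∀ {r} → Point r → Point r → Set
IsEdge {r} u v =
  Σ (Point r) λ c → Σ ℚ λ d →
    (∀ x → InKostkaPolytope x → dot c x ℚ.≤ d) ×
    (∀ (w : Label r) → (dot c (vertex w) ≡ d) ⇔ (vertex w ≈ u ⊎ vertex w ≈ v))

EdgeCondition : ∀ {r} → Label r → Label r → Set
EdgeCondition L L' =
  (a ≡ b × (a' ≡ b' ⊎ a ≡ b' ⊎ a' ℕ.≤ a ⊎ a ℕ.≤ ℓ'))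
  ⊎
  (a ≢ b × (((a ≡ a' × b ≡ b') ⊎ (a ≡ a' × ℓ ≡ ℓ') ⊎ (b ≡ b' × ℓ ≡ ℓ'))
            ⊎ a' ℕ.≤ ℓ ⊎ a ℕ.≤ ℓ'))
  where
    a = Label.a L
    b = Label.b L
    ℓ = Label.ℓ L
    a' = Label.a L'
    b' = Label.b L'
    ℓ' = Label.ℓ L'

module Submission where

-- The Kostka cone is cut out by the facets λ j ≥ λ (1 + j), μ j ≥ μ (1 + j) and Σ_{i<k} μ i ≤ Σ_{i<k} λ i.
-- The support of the ray (a, b, ℓ), i.e. the set of facets not containing it, consists of the drop of λ at b,
-- the drops of μ at a and at ℓ, and, when a ≠ b, the dominance facets with ℓ < k < a.  The vertices u and v
-- span a face iff no third extremal ray w has its support inside supp u ∪ supp v.  If there is no such w, the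
-- sum of the outer normals of the facets containing u and v is a valid functional vanishing exactly at u and v.
-- If there is one, N (u + v) − w lies in the cone for N large, so every valid inequality tight at u and v is
-- tight at w as well.  Finally, a case analysis shows that, when a − b ≤ a′ − b′, such a w exists exactly
-- when the edge condition fails.

module RationalRing where

  open import Data.Rational using (ℚ; 0ℚ)
  open import Data.Rational.Properties using (+-*-commutativeRing; _≟_)
  open import Data.Maybe using (Maybe; just; nothing)
  open import Relation.Binary.PropositionalEquality using (_≡_)
  open import Relation.Nullary using (yes; no)
  open import Level using (0ℓ)
  import Tactic.RingSolver.Core.AlmostCommutativeRing as ACR

  ℚ-ring : ACR.AlmostCommutativeRing 0ℓ 0ℓ
  ℚ-ring = ACR.fromCommutativeRing +-*-commutativeRing is-zero
    where
    is-zero : (x : ℚ) → Maybe (0ℚ ≡ x)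
    is-zero x with 0ℚ ≟ x
    ... | yes p = just p
    ... | no _  = nothing

module Embedding where

  open import Data.Nat as ℕ using (ℕ; suc)
  import Data.Nat.Properties as ℕ
  open import Data.Integer as ℤ using (+_)
  import Data.Integer.Properties as ℤ
  open import Data.Rational using (ℚ; 0ℚ; 1ℚ; -_; _+_; _-_; _*_; _≤_; _<_; _/_; toℚᵘ; NonNegative)
  open import Data.Rational.Properties
  open import Data.Rational.Unnormalised as ℚᵘ using (mkℚᵘ; *≡*; *≤*)
  import Data.Rational.Unnormalised.Properties as ℚᵘ
  open import Relation.Binary.PropositionalEquality
  open import Defs using (ℕ→ℚ; frac)
  open import Tactic.RingSolver using (solve-∀)
  open RationalRing

  private
    toℚᵘ-ℕ→ℚ : ∀ m → toℚᵘ (ℕ→ℚ m) ℚᵘ.≃ mkℚᵘ (+ m) 0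
    toℚᵘ-ℕ→ℚ m = toℚᵘ-fromℚᵘ (mkℚᵘ (+ m) 0)

  ℕ→ℚ-homo-+ : ∀ m n → ℕ→ℚ (m ℕ.+ n) ≡ ℕ→ℚ m + ℕ→ℚ n
  ℕ→ℚ-homo-+ m n = toℚᵘ-injective (begin-equality
    toℚᵘ (ℕ→ℚ (m ℕ.+ n))
      ≃⟨ toℚᵘ-ℕ→ℚ (m ℕ.+ n) ⟩
    mkℚᵘ (+ (m ℕ.+ n)) 0
      ≃⟨ *≡* (cong (ℤ._* + 1) (cong₂ ℤ._+_ (sym (ℤ.*-identityʳ (+ m))) (sym (ℤ.*-identityʳ (+ n))))) ⟩
    mkℚᵘ (+ m) 0 ℚᵘ.+ mkℚᵘ (+ n) 0
      ≃⟨ ℚᵘ.+-cong (toℚᵘ-ℕ→ℚ m) (toℚᵘ-ℕ→ℚ n) ⟨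
    toℚᵘ (ℕ→ℚ m) ℚᵘ.+ toℚᵘ (ℕ→ℚ n)
      ≃⟨ toℚᵘ-homo-+ (ℕ→ℚ m) (ℕ→ℚ n) ⟨
    toℚᵘ (ℕ→ℚ m + ℕ→ℚ n) ∎)
    where open ℚᵘ.≤-Reasoning

  ℕ→ℚ-homo-* : ∀ m n → ℕ→ℚ (m ℕ.* n) ≡ ℕ→ℚ m * ℕ→ℚ n
  ℕ→ℚ-homo-* m n = toℚᵘ-injective (begin-equality
    toℚᵘ (ℕ→ℚ (m ℕ.* n))
      ≃⟨ toℚᵘ-ℕ→ℚ (m ℕ.* n) ⟩
    mkℚᵘ (+ (m ℕ.* n)) 0
      ≃⟨ *≡* (cong (ℤ._* + 1) (ℤ.pos-* m n)) ⟩
    mkℚᵘ (+ m) 0 ℚᵘ.* mkℚᵘ (+ n) 0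
      ≃⟨ ℚᵘ.*-cong (toℚᵘ-ℕ→ℚ m) (toℚᵘ-ℕ→ℚ n) ⟨
    toℚᵘ (ℕ→ℚ m) ℚᵘ.* toℚᵘ (ℕ→ℚ n)
      ≃⟨ toℚᵘ-homo-* (ℕ→ℚ m) (ℕ→ℚ n) ⟨
    toℚᵘ (ℕ→ℚ m * ℕ→ℚ n) ∎)
    where open ℚᵘ.≤-Reasoning

  ℕ→ℚ-homo-∸ : ∀ {m n} → n ℕ.≤ m → ℕ→ℚ (m ℕ.∸ n) ≡ ℕ→ℚ m - ℕ→ℚ n
  ℕ→ℚ-homo-∸ {m} {n} n≤m = begin
    ℕ→ℚ (m ℕ.∸ n)                    ≡⟨ cancel (ℕ→ℚ (m ℕ.∸ n)) (ℕ→ℚ n) ⟨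
    ℕ→ℚ (m ℕ.∸ n) + ℕ→ℚ n - ℕ→ℚ n   ≡⟨ cong (_- ℕ→ℚ n) (ℕ→ℚ-homo-+ (m ℕ.∸ n) n) ⟨
    ℕ→ℚ (m ℕ.∸ n ℕ.+ n) - ℕ→ℚ n      ≡⟨ cong (λ k → ℕ→ℚ k - ℕ→ℚ n) (ℕ.m∸n+n≡m n≤m) ⟩
    ℕ→ℚ m - ℕ→ℚ n                    ∎
    where
    open ≡-Reasoning
    cancel : ∀ x y → x + y - y ≡ x
    cancel = solve-∀ ℚ-ring

  ℕ→ℚ-mono-≤ : ∀ {m n} → m ℕ.≤ n → ℕ→ℚ m ≤ ℕ→ℚ n
  ℕ→ℚ-mono-≤ {m} {n} m≤n = toℚᵘ-cancel-≤ (begin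
    toℚᵘ (ℕ→ℚ m)  ≃⟨ toℚᵘ-ℕ→ℚ m ⟩
    mkℚᵘ (+ m) 0  ≤⟨ *≤* (ℤ.*-monoʳ-≤-nonNeg (+ 1) (ℤ.+≤+ m≤n)) ⟩
    mkℚᵘ (+ n) 0  ≃⟨ toℚᵘ-ℕ→ℚ n ⟨
    toℚᵘ (ℕ→ℚ n) ∎)
    where open ℚᵘ.≤-Reasoning

  ℕ→ℚ-nonNegative : ∀ m → NonNegative (ℕ→ℚ m)
  ℕ→ℚ-nonNegative m = normalize-nonNeg m 1

  neg-ℕ→ℚ≤0 : ∀ m → - ℕ→ℚ m ≤ 0ℚ
  neg-ℕ→ℚ≤0 m = neg-antimono-≤ (ℕ→ℚ-mono-≤ {0} {m} ℕ.z≤n)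

  ℕ→ℚ-injective : ∀ {m n} → ℕ→ℚ m ≡ ℕ→ℚ n → m ≡ n
  ℕ→ℚ-injective {m} {n} eq
    with ℚᵘ.≃-trans (ℚᵘ.≃-sym (toℚᵘ-ℕ→ℚ m)) (ℚᵘ.≃-trans (toℚᵘ-cong eq) (toℚᵘ-ℕ→ℚ n))
  ... | *≡* e = ℤ.+-injective (trans (sym (ℤ.*-identityʳ (+ m))) (trans e (ℤ.*-identityʳ (+ n))))

  1/suc : ℕ → ℚ
  1/suc s = + 1 / suc s

  1/suc-positive : ∀ s → 0ℚ < 1/suc s
  1/suc-positive s = positive⁻¹ (1/suc s) {{normalize-pos 1 (suc s)}}

  1/suc-inverse : ∀ s → 1/suc s * ℕ→ℚ (suc s) ≡ 1ℚ
  1/suc-inverse s = toℚᵘ-injective (begin-equality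
    toℚᵘ (1/suc s * ℕ→ℚ (suc s))
      ≃⟨ toℚᵘ-homo-* (1/suc s) (ℕ→ℚ (suc s)) ⟩
    toℚᵘ (1/suc s) ℚᵘ.* toℚᵘ (ℕ→ℚ (suc s))
      ≃⟨ ℚᵘ.*-cong (toℚᵘ-fromℚᵘ (mkℚᵘ (+ 1) s)) (toℚᵘ-ℕ→ℚ (suc s)) ⟩
    mkℚᵘ (+ 1) s ℚᵘ.* mkℚᵘ (+ suc s) 0
      ≃⟨ *≡* (trans (ℤ.*-identityʳ _)
               (trans (ℤ.*-identityˡ (+ suc s)) (sym (trans (ℤ.*-identityˡ _) (cong +_ (ℕ.*-identityʳ (suc s))))))) ⟩
    mkℚᵘ (+ 1) 0 ∎)
    where open ℚᵘ.≤-Reasoning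

  frac-suc : ∀ m s → frac m (suc s) ≡ 1/suc s * ℕ→ℚ m
  frac-suc m s = toℚᵘ-injective (begin-equality
    toℚᵘ (+ m / suc s)
      ≃⟨ toℚᵘ-fromℚᵘ (mkℚᵘ (+ m) s) ⟩
    mkℚᵘ (+ m) s
      ≃⟨ *≡* (cong₂ ℤ._*_ (sym (ℤ.*-identityˡ (+ m))) (cong (λ k → + suc k) (ℕ.*-identityʳ s))) ⟩
    mkℚᵘ (+ 1) s ℚᵘ.* mkℚᵘ (+ m) 0
      ≃⟨ ℚᵘ.*-cong (toℚᵘ-fromℚᵘ (mkℚᵘ (+ 1) s)) (toℚᵘ-ℕ→ℚ m) ⟨
    toℚᵘ (1/suc s) ℚᵘ.* toℚᵘ (ℕ→ℚ m)
      ≃⟨ toℚᵘ-homo-* (1/suc s) (ℕ→ℚ m) ⟨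
    toℚᵘ (1/suc s * ℕ→ℚ m) ∎)
    where open ℚᵘ.≤-Reasoning

  suc-*-1/suc-* : ∀ s z → ℕ→ℚ (suc s) * (1/suc s * z) ≡ z
  suc-*-1/suc-* s z = begin
    ℕ→ℚ (suc s) * (1/suc s * z)   ≡⟨ *-assoc (ℕ→ℚ (suc s)) (1/suc s) z ⟨
    ℕ→ℚ (suc s) * 1/suc s * z     ≡⟨ cong (_* z) (trans (*-comm (ℕ→ℚ (suc s)) (1/suc s)) (1/suc-inverse s)) ⟩
    1ℚ * z                        ≡⟨ *-identityˡ z ⟩
    z                             ∎
    where open ≡-Reasoning

  1/suc-cancelˡ : ∀ s {x y} → 1/suc s * x ≡ 1/suc s * y → x ≡ y
  1/suc-cancelˡ s {x} {y} eq = trans (sym (suc-*-1/suc-* s x)) (trans (cong (ℕ→ℚ (suc s) *_) eq) (suc-*-1/suc-* s y))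

module Sequences where

  open import Data.Nat
  open import Data.Nat.Properties
  open import Data.Bool using (if_then_else_)
  open import Relation.Nullary using (yes; no)
  open import Data.Sum using (_⊎_; inj₁; inj₂)
  open import Relation.Binary.PropositionalEquality
  open import Algebra.Properties.CommutativeSemigroup +-commutativeSemigroup using (interchange)

  Antitone : (ℕ → ℕ) → Set
  Antitone F = ∀ n → F (suc n) ≤ F n

  antitone-≤ : ∀ {F} → Antitone F → ∀ {m n} → m ≤ n → F n ≤ F m
  antitone-≤ {F} F↓ m≤n = go (≤⇒≤′ m≤n)
    where
    go : ∀ {m n} → m ≤′ n → F n ≤ F m
    go ≤′-refl         = ≤-refl
    go (≤′-step m≤′n) = ≤-trans (F↓ _) (go m≤′n)

  Σ< : ℕ → (ℕ → ℕ) → ℕ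
  Σ< zero    F = 0
  Σ< (suc k) F = F 0 + Σ< k (λ n → F (suc n))

  head≤Σ< : ∀ {k} F → 0 < k → F 0 ≤ Σ< k F
  head≤Σ< {suc k} F _ = m≤m+n (F 0) (Σ< k (λ n → F (suc n)))

  Σ<-cong : ∀ k {F G} → (∀ n → n < k → F n ≡ G n) → Σ< k F ≡ Σ< k G
  Σ<-cong zero    F≡G = refl
  Σ<-cong (suc k) F≡G = cong₂ _+_ (F≡G 0 z<s) (Σ<-cong k (λ n n<k → F≡G (suc n) (s<s n<k)))

  Σ<-zero : ∀ k {F} → (∀ n → n < k → F n ≡ 0) → Σ< k F ≡ 0
  Σ<-zero zero    F≡0 = refl
  Σ<-zero (suc k) F≡0 rewrite F≡0 0 z<s = Σ<-zero k (λ n n<k → F≡0 (suc n) (s<s n<k))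

  Σ<≡0⇒ : ∀ k {F} → Σ< k F ≡ 0 → ∀ n → n < k → F n ≡ 0
  Σ<≡0⇒ (suc k) {F} ΣF≡0 zero    _         = m+n≡0⇒m≡0 (F 0) ΣF≡0
  Σ<≡0⇒ (suc k) {F} ΣF≡0 (suc n) (s<s n<k) = Σ<≡0⇒ k (m+n≡0⇒n≡0 (F 0) ΣF≡0) n n<k

  Σ<-distrib-+ : ∀ k F G → Σ< k (λ n → F n + G n) ≡ Σ< k F + Σ< k G
  Σ<-distrib-+ zero    F G = refl
  Σ<-distrib-+ (suc k) F G rewrite Σ<-distrib-+ k (λ n → F (suc n)) (λ n → G (suc n)) =
    interchange (F 0) (G 0) _ _

  Σ<-*ˡ : ∀ k c F → Σ< k (λ n → c * F n) ≡ c * Σ< k F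
  Σ<-*ˡ zero    c F = sym (*-zeroʳ c)
  Σ<-*ˡ (suc k) c F rewrite Σ<-*ˡ k c (λ n → F (suc n)) = sym (*-distribˡ-+ c (F 0) _)

  Σ<-mono-≤ : ∀ k {F G} → (∀ n → F n ≤ G n) → Σ< k F ≤ Σ< k G
  Σ<-mono-≤ zero    F≤G = z≤n
  Σ<-mono-≤ (suc k) F≤G = +-mono-≤ (F≤G 0) (Σ<-mono-≤ k (λ n → F≤G (suc n)))

  Σ<-≤-* : ∀ k {F B} → (∀ n → F n ≤ B) → Σ< k F ≤ k * B
  Σ<-≤-* zero    F≤B = z≤n
  Σ<-≤-* (suc k) F≤B = +-mono-≤ (F≤B 0) (Σ<-≤-* k (λ n → F≤B (suc n)))

  Σ<-∸ : ∀ k F G → (∀ n → G n ≤ F n) → Σ< k (λ n → F n ∸ G n) ≡ Σ< k F ∸ Σ< k G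
  Σ<-∸ zero    F G G≤F = refl
  Σ<-∸ (suc k) F G G≤F rewrite Σ<-∸ k (λ n → F (suc n)) (λ n → G (suc n)) (λ n → G≤F (suc n)) = begin
    (F 0 ∸ G 0) + (ΣF ∸ ΣG)    ≡⟨ +-∸-assoc (F 0 ∸ G 0) ΣG≤ΣF ⟨
    (F 0 ∸ G 0) + ΣF ∸ ΣG      ≡⟨ cong (_∸ ΣG) (+-∸-comm ΣF (G≤F 0)) ⟨
    F 0 + ΣF ∸ G 0 ∸ ΣG        ≡⟨ ∸-+-assoc (F 0 + ΣF) (G 0) ΣG ⟩
    F 0 + ΣF ∸ (G 0 + ΣG)      ∎
    where
    open ≡-Reasoning
    ΣF = Σ< k (λ n → F (suc n))
    ΣG = Σ< k (λ n → G (suc n))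
    ΣG≤ΣF = Σ<-mono-≤ k (λ n → G≤F (suc n))

  Σ<-indicator : ∀ k t c → Σ< k (λ n → if n <ᵇ t then c else 0) ≡ (k ⊓ t) * c
  Σ<-indicator zero    t       c = refl
  Σ<-indicator (suc k) zero    c = Σ<-zero k (λ _ _ → refl)
  Σ<-indicator (suc k) (suc t) c = cong (c +_) (Σ<-indicator k t c)

  Σ<-scaled-sum∸ : ∀ k N (U V W : ℕ → ℕ) → (∀ n → W n ≤ N * (U n + V n)) →
    Σ< k (λ n → N * (U n + V n) ∸ W n) ≡ N * (Σ< k U + Σ< k V) ∸ Σ< k W
  Σ<-scaled-sum∸ k N U V W W≤ = begin
    Σ< k (λ n → N * (U n + V n) ∸ W n)       ≡⟨ Σ<-∸ k (λ n → N * (U n + V n)) W W≤ ⟩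
    Σ< k (λ n → N * (U n + V n)) ∸ Σ< k W    ≡⟨ cong (_∸ Σ< k W) (Σ<-*ˡ k N (λ n → U n + V n)) ⟩
    N * Σ< k (λ n → U n + V n) ∸ Σ< k W      ≡⟨ cong (λ s → N * s ∸ Σ< k W) (Σ<-distrib-+ k U V) ⟩
    N * (Σ< k U + Σ< k V) ∸ Σ< k W           ∎
    where open ≡-Reasoning

  m+p≤o+n⇒m∸n≤o∸p : ∀ {m n o p} → m + p ≤ o + n → m ∸ n ≤ o ∸ p
  m+p≤o+n⇒m∸n≤o∸p {m} {n} {o} {p} m+p≤o+n = begin
    m ∸ n              ≤⟨ ∸-monoˡ-≤ n (m+n≤o⇒m≤o∸n m m+p≤o+n) ⟩
    o + n ∸ p ∸ n      ≡⟨ ∸-+-assoc (o + n) p n ⟩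
    o + n ∸ (p + n)    ≡⟨ cong₂ _∸_ (+-comm o n) (+-comm p n) ⟩
    n + o ∸ (n + p)    ≡⟨ [m+n]∸[m+o]≡n∸o n o p ⟩
    o ∸ p              ∎
    where open ≤-Reasoning

  -- The monotonicity step shared by the entries and the prefix sums of N (u + v) ∸ w.
  scaled-sum∸-mono : ∀ N {u u′ v v′ w w′} → u′ ≤ u → v′ ≤ v → w ≤ N →
    (w′ < w → u′ < u ⊎ v′ < v) → N * (u′ + v′) ∸ w′ ≤ N * (u + v) ∸ w
  scaled-sum∸-mono N {u} {u′} {v} {v′} {w} {w′} u′≤u v′≤v w≤N covered with <-≤-connex w′ w
  ... | inj₂ w≤w′ = m+p≤o+n⇒m∸n≤o∸p {N * (u′ + v′)} {w′} {N * (u + v)} {w}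
    (+-mono-≤ (*-monoʳ-≤ N (+-mono-≤ u′≤u v′≤v)) w≤w′)
  ... | inj₁ w′<w = m+p≤o+n⇒m∸n≤o∸p {N * (u′ + v′)} {w′} {N * (u + v)} {w} (begin
    N * (u′ + v′) + w      ≤⟨ +-monoʳ-≤ (N * (u′ + v′)) w≤N ⟩
    N * (u′ + v′) + N      ≡⟨ +-comm (N * (u′ + v′)) N ⟩
    N + N * (u′ + v′)      ≡⟨ *-suc N (u′ + v′) ⟨
    N * suc (u′ + v′)      ≤⟨ *-monoʳ-≤ N (sum-< (covered w′<w)) ⟩
    N * (u + v)            ≤⟨ m≤m+n (N * (u + v)) w′ ⟩
    N * (u + v) + w′       ∎)
    where
    open ≤-Reasoning
    sum-< : u′ < u ⊎ v′ < v → u′ + v′ < u + v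
    sum-< (inj₁ u′<u) = +-mono-<-≤ u′<u v′≤v
    sum-< (inj₂ v′<v) = +-mono-≤-< u′≤u v′<v

  -- Descending induction from a point where W vanishes.
  ≤-scaled-sum : ∀ N {U V W} → Antitone U → Antitone V → (∀ n → W n ≤ N) →
    (∀ n → W (suc n) < W n → U (suc n) < U n ⊎ V (suc n) < V n) →
    ∀ r → (∀ n → r ≤ n → W n ≡ 0) → ∀ n → W n ≤ N * (U n + V n)
  ≤-scaled-sum N {U} {V} {W} U↓ V↓ W≤N covered r W≡0 n = go r n (W≡0 (r + n) (m≤m+n r n))
    where
    go : ∀ d n → W (d + n) ≡ 0 → W n ≤ N * (U n + V n)
    go zero    n W≡0 = ≤-trans (≤-reflexive W≡0) z≤n
    go (suc d) n W≡0 with W (suc n) <? W n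
    ... | yes W↓ = ≤-trans (W≤N n) (≤-trans (≤-reflexive (sym (*-identityʳ N))) (*-monoʳ-≤ N (positive (covered n W↓))))
      where
      positive : U (suc n) < U n ⊎ V (suc n) < V n → 1 ≤ U n + V n
      positive (inj₁ U↓) = ≤-trans (≤-trans z<s U↓) (m≤m+n (U n) (V n))
      positive (inj₂ V↓) = ≤-trans (≤-trans z<s V↓) (m≤n+m (V n) (U n))
    ... | no ¬W↓ = begin
      W n                             ≤⟨ ≮⇒≥ ¬W↓ ⟩
      W (suc n)                       ≤⟨ go d (suc n) (trans (cong W (+-suc d n)) W≡0) ⟩
      N * (U (suc n) + V (suc n))     ≤⟨ *-monoʳ-≤ N (+-mono-≤ (U↓ n) (V↓ n)) ⟩
      N * (U n + V n)                 ∎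
      where open ≤-Reasoning

module Vectors where

  open import Data.Nat using (zero; suc)
  open import Data.Fin using (Fin)
  open import Data.Rational using (ℚ; 0ℚ; 1ℚ; -_; _+_; _-_; _*_)
  open import Data.Rational.Properties using (+-*-commutativeRing; *-distribˡ-+; *-distribʳ-+; *-assoc; *-zeroˡ; *-zeroʳ; *-identityˡ)
  open import Data.Product using (_,_; proj₁; proj₂)
  open import Algebra.Bundles using (CommutativeRing)
  open import Relation.Binary.PropositionalEquality
  open import Defs using (Point; sumℚ; dot; total; _≈_)
  open import Tactic.RingSolver using (solve-∀)
  open RationalRing
  import Algebra.Properties.Semiring.Sum (CommutativeRing.semiring +-*-commutativeRing) as ∑

  sumℚ≡sum : ∀ {r} (f : Fin r → ℚ) → sumℚ f ≡ ∑.sum f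
  sumℚ≡sum {zero}  f = refl
  sumℚ≡sum {suc r} f = cong (f Fin.zero +_) (sumℚ≡sum (λ i → f (Fin.suc i)))

  sumℚ-cong : ∀ {r} {f g : Fin r → ℚ} → (∀ i → f i ≡ g i) → sumℚ f ≡ sumℚ g
  sumℚ-cong {f = f} {g} f≗g = trans (sumℚ≡sum f) (trans (∑.sum-cong-≗ {x = f} {y = g} f≗g) (sym (sumℚ≡sum g)))

  sumℚ-zero : ∀ r → sumℚ {r} (λ _ → 0ℚ) ≡ 0ℚ
  sumℚ-zero r = trans (sumℚ≡sum {r} (λ _ → 0ℚ)) (∑.sum-replicate-zero r)

  sumℚ-distrib-+ : ∀ {r} (f g : Fin r → ℚ) → sumℚ (λ i → f i + g i) ≡ sumℚ f + sumℚ g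
  sumℚ-distrib-+ f g = trans (sumℚ≡sum (λ i → f i + g i))
    (trans (∑.∑-distrib-+ f g) (sym (cong₂ _+_ (sumℚ≡sum f) (sumℚ≡sum g))))

  sumℚ-*ˡ : ∀ {r} t (f : Fin r → ℚ) → sumℚ (λ i → t * f i) ≡ t * sumℚ f
  sumℚ-*ˡ t f = trans (sumℚ≡sum (λ i → t * f i)) (sym (trans (cong (t *_) (sumℚ≡sum f)) (∑.*-distribˡ-sum t f)))

  sumℚ-0* : ∀ {r} (f : Fin r → ℚ) → sumℚ (λ i → 0ℚ * f i) ≡ 0ℚ
  sumℚ-0* f = trans (sumℚ-*ˡ 0ℚ f) (*-zeroˡ (sumℚ f))

  infixl 6 _⊕_ _⊖_
  infixl 7 _•_

  _⊕_ : ∀ {r} → Point r → Point r → Point r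
  x ⊕ y = (λ i → proj₁ x i + proj₁ y i) , (λ i → proj₂ x i + proj₂ y i)

  _⊖_ : ∀ {r} → Point r → Point r → Point r
  x ⊖ y = (λ i → proj₁ x i - proj₁ y i) , (λ i → proj₂ x i - proj₂ y i)

  _•_ : ∀ {r} → ℚ → Point r → Point r
  t • x = (λ i → t * proj₁ x i) , (λ i → t * proj₂ x i)

  0ᵥ : ∀ {r} → Point r
  0ᵥ = (λ _ → 0ℚ) , (λ _ → 0ℚ)

  𝟙 : ∀ {r} → Point r
  𝟙 = (λ _ → 1ℚ) , (λ _ → 1ℚ)

  ≈-refl : ∀ {r} {x : Point r} → x ≈ x
  ≈-refl = (λ _ → refl) , (λ _ → refl)

  dot-congʳ : ∀ {r} (c : Point r) {x y} → x ≈ y → dot c x ≡ dot c y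
  dot-congʳ c (x₁≡y₁ , x₂≡y₂) =
    cong₂ _+_ (sumℚ-cong (λ i → cong (proj₁ c i *_) (x₁≡y₁ i))) (sumℚ-cong (λ i → cong (proj₂ c i *_) (x₂≡y₂ i)))

  dot-congˡ : ∀ {r} {c d : Point r} → c ≈ d → ∀ x → dot c x ≡ dot d x
  dot-congˡ (c₁≡d₁ , c₂≡d₂) (x₁ , x₂) =
    cong₂ _+_ (sumℚ-cong (λ i → cong (_* x₁ i) (c₁≡d₁ i))) (sumℚ-cong (λ i → cong (_* x₂ i) (c₂≡d₂ i)))

  private
    minus : ∀ a b → a - b ≡ a + (- 1ℚ) * b
    minus = solve-∀ ℚ-ring

    interchange : ∀ a b c d → (a + b) + (c + d) ≡ (a + c) + (b + d)
    interchange = solve-∀ ℚ-ring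

    ⟨_,_⟩ : ∀ {r} → (Fin r → ℚ) → (Fin r → ℚ) → ℚ
    ⟨ c , x ⟩ = sumℚ (λ i → c i * x i)

    ⟨⟩-+ʳ : ∀ {r} (c x y : Fin r → ℚ) → ⟨ c , (λ i → x i + y i) ⟩ ≡ ⟨ c , x ⟩ + ⟨ c , y ⟩
    ⟨⟩-+ʳ c x y = trans (sumℚ-cong (λ i → *-distribˡ-+ (c i) (x i) (y i))) (sumℚ-distrib-+ (λ i → c i * x i) (λ i → c i * y i))

    ⟨⟩-+ˡ : ∀ {r} (c d x : Fin r → ℚ) → ⟨ (λ i → c i + d i) , x ⟩ ≡ ⟨ c , x ⟩ + ⟨ d , x ⟩
    ⟨⟩-+ˡ c d x = trans (sumℚ-cong (λ i → *-distribʳ-+ (x i) (c i) (d i))) (sumℚ-distrib-+ (λ i → c i * x i) (λ i → d i * x i))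

    ⟨⟩-*ʳ : ∀ {r} t (c x : Fin r → ℚ) → ⟨ c , (λ i → t * x i) ⟩ ≡ t * ⟨ c , x ⟩
    ⟨⟩-*ʳ t c x = trans (sumℚ-cong (λ i → *-comm-middle (c i) t (x i))) (sumℚ-*ˡ t (λ i → c i * x i))
      where
      *-comm-middle : ∀ a b c → a * (b * c) ≡ b * (a * c)
      *-comm-middle = solve-∀ ℚ-ring

    ⟨⟩-*ˡ : ∀ {r} t (c x : Fin r → ℚ) → ⟨ (λ i → t * c i) , x ⟩ ≡ t * ⟨ c , x ⟩
    ⟨⟩-*ˡ t c x = trans (sumℚ-cong (λ i → *-assoc t (c i) (x i))) (sumℚ-*ˡ t (λ i → c i * x i))

  dot-⊕ʳ : ∀ {r} (c x y : Point r) → dot c (x ⊕ y) ≡ dot c x + dot c y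
  dot-⊕ʳ (c₁ , c₂) (x₁ , x₂) (y₁ , y₂) = trans (cong₂ _+_ (⟨⟩-+ʳ c₁ x₁ y₁) (⟨⟩-+ʳ c₂ x₂ y₂))
    (interchange ⟨ c₁ , x₁ ⟩ ⟨ c₁ , y₁ ⟩ ⟨ c₂ , x₂ ⟩ ⟨ c₂ , y₂ ⟩)

  dot-⊕ˡ : ∀ {r} (c d x : Point r) → dot (c ⊕ d) x ≡ dot c x + dot d x
  dot-⊕ˡ (c₁ , c₂) (d₁ , d₂) (x₁ , x₂) = trans (cong₂ _+_ (⟨⟩-+ˡ c₁ d₁ x₁) (⟨⟩-+ˡ c₂ d₂ x₂))
    (interchange ⟨ c₁ , x₁ ⟩ ⟨ d₁ , x₁ ⟩ ⟨ c₂ , x₂ ⟩ ⟨ d₂ , x₂ ⟩)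

  dot-•ʳ : ∀ {r} (c : Point r) t x → dot c (t • x) ≡ t * dot c x
  dot-•ʳ (c₁ , c₂) t (x₁ , x₂) = trans (cong₂ _+_ (⟨⟩-*ʳ t c₁ x₁) (⟨⟩-*ʳ t c₂ x₂))
    (sym (*-distribˡ-+ t ⟨ c₁ , x₁ ⟩ ⟨ c₂ , x₂ ⟩))

  dot-•ˡ : ∀ {r} t (c x : Point r) → dot (t • c) x ≡ t * dot c x
  dot-•ˡ t (c₁ , c₂) (x₁ , x₂) = trans (cong₂ _+_ (⟨⟩-*ˡ t c₁ x₁) (⟨⟩-*ˡ t c₂ x₂))
    (sym (*-distribˡ-+ t ⟨ c₁ , x₁ ⟩ ⟨ c₂ , x₂ ⟩))

  dot-⊖ʳ : ∀ {r} (c x y : Point r) → dot c (x ⊖ y) ≡ dot c x - dot c y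
  dot-⊖ʳ c x y = begin
    dot c (x ⊖ y)                  ≡⟨ dot-congʳ c ((λ i → minus (proj₁ x i) (proj₁ y i))
                                                  , (λ i → minus (proj₂ x i) (proj₂ y i))) ⟩
    dot c (x ⊕ - 1ℚ • y)           ≡⟨ dot-⊕ʳ c x (- 1ℚ • y) ⟩
    dot c x + dot c (- 1ℚ • y)     ≡⟨ cong (dot c x +_) (dot-•ʳ c (- 1ℚ) y) ⟩
    dot c x + (- 1ℚ) * dot c y     ≡⟨ minus (dot c x) (dot c y) ⟨
    dot c x - dot c y              ∎
    where open ≡-Reasoning

  dot-⊖ˡ : ∀ {r} (c d x : Point r) → dot (c ⊖ d) x ≡ dot c x - dot d x
  dot-⊖ˡ c d x = begin
    dot (c ⊖ d) x                  ≡⟨ dot-congˡ ((λ i → minus (proj₁ c i) (proj₁ d i))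
                                                 , (λ i → minus (proj₂ c i) (proj₂ d i))) x ⟩
    dot (c ⊕ - 1ℚ • d) x           ≡⟨ dot-⊕ˡ c (- 1ℚ • d) x ⟩
    dot c x + dot (- 1ℚ • d) x     ≡⟨ cong (dot c x +_) (dot-•ˡ (- 1ℚ) d x) ⟩
    dot c x + (- 1ℚ) * dot d x     ≡⟨ minus (dot c x) (dot d x) ⟨
    dot c x - dot d x              ∎
    where open ≡-Reasoning

  dot-0ˡ : ∀ {r} (x : Point r) → dot 0ᵥ x ≡ 0ℚ
  dot-0ˡ (x₁ , x₂) = cong₂ _+_ (sumℚ-0* x₁) (sumℚ-0* x₂)

  dot-0ʳ : ∀ {r} (c : Point r) → dot c 0ᵥ ≡ 0ℚ
  dot-0ʳ {r} (c₁ , c₂) = cong₂ _+_ (zero-terms c₁) (zero-terms c₂)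
    where
    zero-terms : (f : Fin r → ℚ) → sumℚ (λ i → f i * 0ℚ) ≡ 0ℚ
    zero-terms f = trans (sumℚ-cong (λ i → *-zeroʳ (f i))) (sumℚ-zero r)

  total≡dot𝟙 : ∀ {r} (x : Point r) → total x ≡ dot 𝟙 x
  total≡dot𝟙 (x₁ , x₂) =
    cong₂ _+_ (sumℚ-cong (λ i → sym (*-identityˡ (x₁ i)))) (sumℚ-cong (λ i → sym (*-identityˡ (x₂ i))))

module Rays where

  open import Data.Nat
  open import Data.Nat.Properties
  open import Data.Bool using (true; false; if_then_else_)
  open import Data.Product using (_×_; _,_)
  open import Data.Sum using (_⊎_; inj₁; inj₂)
  open import Relation.Nullary using (¬_; yes; no; contradiction)
  open import Relation.Binary.PropositionalEquality
  open import Data.Nat.Tactic.RingSolver using (solve-∀)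
  open Sequences

  Triple : Set
  Triple = ℕ × ℕ × ℕ

  -- For a = b the ray does not depend on ℓ; as in Defs.rayℓ, it is indexed with ℓ = 0.
  data Extremal : Triple → Set where
    off-diagonal : ∀ {a b ℓ} → ℓ < b → b < a → Extremal (a , b , ℓ)
    diagonal     : ∀ {a} → 1 ≤ a → Extremal (a , a , 0)

  rλ : Triple → ℕ → ℕ
  rλ (a , b , ℓ) n = if n <ᵇ b then a ∸ ℓ else 0

  rμ : Triple → ℕ → ℕ
  rμ (a , b , ℓ) n = if n <ᵇ ℓ then a ∸ ℓ else (if n <ᵇ a then b ∸ ℓ else 0)

  module _ {a b ℓ : ℕ} where

    extremal-ℓ<b : Extremal (a , b , ℓ) → ℓ < b
    extremal-ℓ<b (off-diagonal ℓ<b _) = ℓ<b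
    extremal-ℓ<b (diagonal 1≤a)       = 1≤a

    extremal-b≤a : Extremal (a , b , ℓ) → b ≤ a
    extremal-b≤a (off-diagonal _ b<a) = <⇒≤ b<a
    extremal-b≤a (diagonal _)         = ≤-refl

    extremal-ℓ<a : Extremal (a , b , ℓ) → ℓ < a
    extremal-ℓ<a e = <-≤-trans (extremal-ℓ<b e) (extremal-b≤a e)

    extremal-1≤b : Extremal (a , b , ℓ) → 1 ≤ b
    extremal-1≤b e = ≤-<-trans z≤n (extremal-ℓ<b e)

    extremal-1≤a : Extremal (a , b , ℓ) → 1 ≤ a
    extremal-1≤a e = ≤-trans (extremal-1≤b e) (extremal-b≤a e)

  private
    <ᵇ-true : ∀ {m n} → m < n → (m <ᵇ n) ≡ true
    <ᵇ-true {zero}  {suc n} _         = refl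
    <ᵇ-true {suc m} {suc n} (s<s m<n) = <ᵇ-true m<n

    <ᵇ-false : ∀ {m n} → n ≤ m → (m <ᵇ n) ≡ false
    <ᵇ-false {m}     {zero}  _         = refl
    <ᵇ-false {suc m} {suc n} (s≤s n≤m) = <ᵇ-false n≤m

  module _ {a b ℓ n : ℕ} where

    rλ-< : n < b → rλ (a , b , ℓ) n ≡ a ∸ ℓ
    rλ-< n<b rewrite <ᵇ-true n<b = refl

    rλ-≥ : b ≤ n → rλ (a , b , ℓ) n ≡ 0
    rλ-≥ b≤n rewrite <ᵇ-false b≤n = refl

    rμ-<ℓ : n < ℓ → rμ (a , b , ℓ) n ≡ a ∸ ℓ
    rμ-<ℓ n<ℓ rewrite <ᵇ-true n<ℓ = refl

    rμ-mid : ℓ ≤ n → n < a → rμ (a , b , ℓ) n ≡ b ∸ ℓ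
    rμ-mid ℓ≤n n<a rewrite <ᵇ-false ℓ≤n | <ᵇ-true n<a = refl

    rμ-≥ : ℓ ≤ a → a ≤ n → rμ (a , b , ℓ) n ≡ 0
    rμ-≥ ℓ≤a a≤n rewrite <ᵇ-false (≤-trans ℓ≤a a≤n) | <ᵇ-false a≤n = refl

    rλ-≤ : rλ (a , b , ℓ) n ≤ a
    rλ-≤ with n <ᵇ b
    ... | true  = m∸n≤m a ℓ
    ... | false = z≤n

    rμ-≤ : b ≤ a → rμ (a , b , ℓ) n ≤ a
    rμ-≤ b≤a with n <ᵇ ℓ | n <ᵇ a
    ... | true  | _     = m∸n≤m a ℓ
    ... | false | true  = ≤-trans (m∸n≤m b ℓ) b≤a
    ... | false | false = z≤n

  module _ {a b ℓ : ℕ} (j : ℕ) where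

    rλ-flat : suc j ≢ b → rλ (a , b , ℓ) (suc j) ≡ rλ (a , b , ℓ) j
    rλ-flat j+1≢b with suc j <? b
    ... | yes j+1<b = trans (rλ-< {a} {b} {ℓ} j+1<b) (sym (rλ-< {a} {b} {ℓ} (<-trans (n<1+n j) j+1<b)))
    ... | no  j+1≮b = trans (rλ-≥ {a} {b} {ℓ} b≤j+1) (sym (rλ-≥ {a} {b} {ℓ} (≤-pred (≤∧≢⇒< b≤j+1 (≢-sym j+1≢b)))))
      where b≤j+1 = ≮⇒≥ j+1≮b

    rλ-drop : Extremal (a , b , ℓ) → suc j ≡ b → rλ (a , b , ℓ) (suc j) < rλ (a , b , ℓ) j
    rλ-drop e refl rewrite rλ-≥ {a} {suc j} {ℓ} ≤-refl | rλ-< {a} {suc j} {ℓ} (n<1+n j) =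
      m<n⇒0<n∸m (extremal-ℓ<a e)

    rμ-flat : ℓ ≤ a → suc j ≢ a → suc j ≢ ℓ → rμ (a , b , ℓ) (suc j) ≡ rμ (a , b , ℓ) j
    rμ-flat ℓ≤a j+1≢a j+1≢ℓ with suc j <? ℓ | suc j <? a
    ... | yes j+1<ℓ | _ = trans (rμ-<ℓ {a} {b} j+1<ℓ) (sym (rμ-<ℓ {a} {b} (<-trans (n<1+n j) j+1<ℓ)))
    ... | no j+1≮ℓ | yes j+1<a = trans (rμ-mid {a} {b} (≮⇒≥ j+1≮ℓ) j+1<a) (sym (rμ-mid {a} {b} ℓ≤j (<-trans (n<1+n j) j+1<a)))
      where ℓ≤j = ≤-pred (≤∧≢⇒< (≮⇒≥ j+1≮ℓ) (≢-sym j+1≢ℓ))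
    ... | no _ | no j+1≮a = trans (rμ-≥ {a} {b} ℓ≤a a≤j+1) (sym (rμ-≥ {a} {b} ℓ≤a (≤-pred (≤∧≢⇒< a≤j+1 (≢-sym j+1≢a)))))
      where a≤j+1 = ≮⇒≥ j+1≮a

    rμ-drop : Extremal (a , b , ℓ) → suc j ≡ a ⊎ suc j ≡ ℓ → rμ (a , b , ℓ) (suc j) < rμ (a , b , ℓ) j
    rμ-drop e (inj₁ refl) rewrite rμ-≥ {suc j} {b} {ℓ} (<⇒≤ (extremal-ℓ<a e)) ≤-refl
                                | rμ-mid {suc j} {b} {ℓ} (≤-pred (extremal-ℓ<a e)) (n<1+n j) = m<n⇒0<n∸m (extremal-ℓ<b e)
    rμ-drop (off-diagonal ℓ<b b<a) (inj₂ refl) rewrite rμ-mid {a} {b} {suc j} ≤-refl (<-trans ℓ<b b<a)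
                                                     | rμ-<ℓ {a} {b} {suc j} (n<1+n j) = ∸-monoˡ-< b<a (<⇒≤ ℓ<b)

  module _ {a b ℓ : ℕ} (e : Extremal (a , b , ℓ)) where

    rλ-antitone : Antitone (rλ (a , b , ℓ))
    rλ-antitone j with suc j ≟ b
    ... | yes j+1≡b = <⇒≤ (rλ-drop j e j+1≡b)
    ... | no  j+1≢b = ≤-reflexive (rλ-flat {a} {b} {ℓ} j j+1≢b)

    rμ-antitone : Antitone (rμ (a , b , ℓ))
    rμ-antitone j with suc j ≟ a | suc j ≟ ℓ
    ... | yes j+1≡a | _         = <⇒≤ (rμ-drop j e (inj₁ j+1≡a))
    ... | no _      | yes j+1≡ℓ = <⇒≤ (rμ-drop j e (inj₂ j+1≡ℓ))
    ... | no j+1≢a  | no j+1≢ℓ  = ≤-reflexive (rμ-flat {a} {b} {ℓ} j (<⇒≤ (extremal-ℓ<a e)) j+1≢a j+1≢ℓ)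

  Gap : Triple → ℕ → Set
  Gap (a , b , ℓ) k = ℓ < k × k < a × a ≢ b

  -- Closed forms of the prefix sums, with b = ℓ + p and a = ℓ + p + q to avoid truncated subtraction.
  private
    Σ<-rλ-closed : ∀ ℓ p q k → Σ< k (rλ (ℓ + p + q , ℓ + p , ℓ)) ≡ (k ⊓ (ℓ + p)) * (p + q)
    Σ<-rλ-closed ℓ p q k rewrite Σ<-indicator k (ℓ + p) (ℓ + p + q ∸ ℓ) | +-assoc ℓ p q | m+n∸m≡n ℓ (p + q) = refl

    -- For n < ℓ the value a ∸ ℓ of rμ splits as (a ∸ b) + (b ∸ ℓ).
    rμ-split : ∀ ℓ p q n → rμ (ℓ + p + q , ℓ + p , ℓ) n ≡ (if n <ᵇ ℓ then q else 0) + (if n <ᵇ ℓ + p + q then p else 0)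
    rμ-split ℓ p q n with n <? ℓ | n <? ℓ + p + q
    ... | yes n<ℓ | yes n<a rewrite <ᵇ-true n<ℓ | <ᵇ-true n<a | +-assoc ℓ p q | m+n∸m≡n ℓ (p + q) = +-comm p q
    ... | yes n<ℓ | no n≮a  = contradiction (<-≤-trans n<ℓ (≤-trans (m≤m+n ℓ p) (m≤m+n (ℓ + p) q))) n≮a
    ... | no n≮ℓ  | yes n<a rewrite <ᵇ-false (≮⇒≥ n≮ℓ) | <ᵇ-true n<a | m+n∸m≡n ℓ p = refl
    ... | no n≮ℓ  | no n≮a  rewrite <ᵇ-false (≮⇒≥ n≮ℓ) | <ᵇ-false (≮⇒≥ n≮a) = refl

    Σ<-rμ-closed : ∀ ℓ p q k → Σ< k (rμ (ℓ + p + q , ℓ + p , ℓ)) ≡ (k ⊓ ℓ) * q + (k ⊓ (ℓ + p + q)) * p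
    Σ<-rμ-closed ℓ p q k = begin
      Σ< k (rμ (ℓ + p + q , ℓ + p , ℓ))
        ≡⟨ Σ<-cong k (λ n _ → rμ-split ℓ p q n) ⟩
      Σ< k (λ n → (if n <ᵇ ℓ then q else 0) + (if n <ᵇ ℓ + p + q then p else 0))
        ≡⟨ Σ<-distrib-+ k _ _ ⟩
      Σ< k (λ n → if n <ᵇ ℓ then q else 0) + Σ< k (λ n → if n <ᵇ ℓ + p + q then p else 0)
        ≡⟨ cong₂ _+_ (Σ<-indicator k ℓ q) (Σ<-indicator k (ℓ + p + q) p) ⟩
      (k ⊓ ℓ) * q + (k ⊓ (ℓ + p + q)) * p ∎
      where open ≡-Reasoning

    -- Σ< k rλ − Σ< k rμ is 0 up to k = ℓ, grows with slope a − b up to b, falls with slope b − ℓ to 0 at a, and stays 0.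
    module Regimes {a b ℓ : ℕ} (ℓ≤b : ℓ ≤ b) (b≤a : b ≤ a) where

      before-ℓ : ∀ k → k ≤ ℓ → Σ< k (rμ (a , b , ℓ)) ≡ Σ< k (rλ (a , b , ℓ))
      before-ℓ k k≤ℓ with m≤n⇒∃[o]m+o≡n ℓ≤b
      ... | p , refl with m≤n⇒∃[o]m+o≡n b≤a
      ... | q , refl rewrite Σ<-rλ-closed ℓ p q k | Σ<-rμ-closed ℓ p q k
          | m≤n⇒m⊓n≡m k≤ℓ | m≤n⇒m⊓n≡m (≤-trans k≤ℓ (m≤m+n ℓ p))
          | m≤n⇒m⊓n≡m (≤-trans k≤ℓ (≤-trans (m≤m+n ℓ p) (m≤m+n (ℓ + p) q))) = sym (identity k p q)
        where
        identity : ∀ k p q → k * (p + q) ≡ k * q + k * p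
        identity = solve-∀

      rising : ∀ k → ℓ ≤ k → k ≤ b → Σ< k (rλ (a , b , ℓ)) ≡ Σ< k (rμ (a , b , ℓ)) + (k ∸ ℓ) * (a ∸ b)
      rising k ℓ≤k k≤b with m≤n⇒∃[o]m+o≡n ℓ≤b
      ... | p , refl with m≤n⇒∃[o]m+o≡n b≤a
      ... | q , refl with m≤n⇒∃[o]m+o≡n ℓ≤k
      ... | m , refl rewrite Σ<-rλ-closed ℓ p q (ℓ + m) | Σ<-rμ-closed ℓ p q (ℓ + m)
          | m≤n⇒m⊓n≡m k≤b | m≥n⇒m⊓n≡n ℓ≤k | m≤n⇒m⊓n≡m (≤-trans k≤b (m≤m+n (ℓ + p) q))
          | m+n∸m≡n ℓ m | m+n∸m≡n (ℓ + p) q = identity ℓ m p q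
        where
        identity : ∀ ℓ m p q → (ℓ + m) * (p + q) ≡ ℓ * q + (ℓ + m) * p + m * q
        identity = solve-∀

      falling : ∀ k → b ≤ k → k ≤ a → Σ< k (rλ (a , b , ℓ)) ≡ Σ< k (rμ (a , b , ℓ)) + (b ∸ ℓ) * (a ∸ k)
      falling k b≤k k≤a with m≤n⇒∃[o]m+o≡n ℓ≤b
      ... | p , refl with m≤n⇒∃[o]m+o≡n b≤a
      ... | q , refl with m≤n⇒∃[o]m+o≡n b≤k
      ... | m , refl with m≤n⇒∃[o]m+o≡n (+-cancelˡ-≤ (ℓ + p) m q k≤a)
      ... | n , refl rewrite Σ<-rλ-closed ℓ p (m + n) (ℓ + p + m) | Σ<-rμ-closed ℓ p (m + n) (ℓ + p + m)
          | m≥n⇒m⊓n≡n b≤k | m≥n⇒m⊓n≡n (≤-trans (m≤m+n ℓ p) b≤k) | m≤n⇒m⊓n≡m k≤a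
          | m+n∸m≡n ℓ p | sym (+-assoc (ℓ + p) m n) | m+n∸m≡n (ℓ + p + m) n = identity ℓ p m n
        where
        identity : ∀ ℓ p m n → (ℓ + p) * (p + (m + n)) ≡ ℓ * (m + n) + (ℓ + p + m) * p + p * n
        identity = solve-∀

      after-a : ∀ k → a ≤ k → Σ< k (rμ (a , b , ℓ)) ≡ Σ< k (rλ (a , b , ℓ))
      after-a k a≤k with m≤n⇒∃[o]m+o≡n ℓ≤b
      ... | p , refl with m≤n⇒∃[o]m+o≡n b≤a
      ... | q , refl rewrite Σ<-rλ-closed ℓ p q k | Σ<-rμ-closed ℓ p q k
          | m≥n⇒m⊓n≡n (≤-trans (m≤m+n (ℓ + p) q) a≤k)
          | m≥n⇒m⊓n≡n (≤-trans (≤-trans (m≤m+n ℓ p) (m≤m+n (ℓ + p) q)) a≤k)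
          | m≥n⇒m⊓n≡n a≤k = sym (identity ℓ p q)
        where
        identity : ∀ ℓ p q → (ℓ + p) * (p + q) ≡ ℓ * q + (ℓ + p + q) * p
        identity = solve-∀

  module _ {a b ℓ : ℕ} (e : Extremal (a , b , ℓ)) (k : ℕ) where
    private
      open Regimes (<⇒≤ (extremal-ℓ<b e)) (extremal-b≤a e)
      Σλ = Σ< k (rλ (a , b , ℓ))
      Σμ = Σ< k (rμ (a , b , ℓ))

    Σ<-rμ≤rλ : Σμ ≤ Σλ
    Σ<-rμ≤rλ with k ≤? ℓ | k ≤? b | k ≤? a
    ... | yes k≤ℓ | _       | _       = ≤-reflexive (before-ℓ k k≤ℓ)
    ... | no k≰ℓ  | yes k≤b | _       = subst (Σμ ≤_) (sym (rising k (<⇒≤ (≰⇒> k≰ℓ)) k≤b)) (m≤m+n Σμ _)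
    ... | no _    | no k≰b  | yes k≤a = subst (Σμ ≤_) (sym (falling k (<⇒≤ (≰⇒> k≰b)) k≤a)) (m≤m+n Σμ _)
    ... | no _    | no _    | no k≰a  = ≤-reflexive (after-a k (<⇒≤ (≰⇒> k≰a)))

    Σ<-rμ<rλ : Gap (a , b , ℓ) k → Σμ < Σλ
    Σ<-rμ<rλ (ℓ<k , k<a , a≢b) with k ≤? b
    ... | yes k≤b = subst (Σμ <_) (sym (rising k (<⇒≤ ℓ<k) k≤b))
          (m<m+n Σμ (*-mono-< (m<n⇒0<n∸m ℓ<k) (m<n⇒0<n∸m b<a)))
      where b<a = ≤∧≢⇒< (extremal-b≤a e) (≢-sym a≢b)
    ... | no k≰b = subst (Σμ <_) (sym (falling k (<⇒≤ (≰⇒> k≰b)) (<⇒≤ k<a)))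
          (m<m+n Σμ (*-mono-< (m<n⇒0<n∸m (extremal-ℓ<b e)) (m<n⇒0<n∸m k<a)))

    Σ<-rμ≡rλ : ¬ Gap (a , b , ℓ) k → Σμ ≡ Σλ
    Σ<-rμ≡rλ ¬gap with k ≤? ℓ | a ≤? k | a ≟ b
    ... | yes k≤ℓ | _       | _     = before-ℓ k k≤ℓ
    ... | no _    | yes a≤k | _     = after-a k a≤k
    ... | no k≰ℓ  | no a≰k  | no a≢b = contradiction (≰⇒> k≰ℓ , ≰⇒> a≰k , a≢b) ¬gap
    ... | no k≰ℓ  | no a≰k  | yes a≡b = sym (begin
      Σλ                        ≡⟨ rising k (<⇒≤ (≰⇒> k≰ℓ)) (subst (k ≤_) a≡b (<⇒≤ (≰⇒> a≰k))) ⟩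
      Σμ + (k ∸ ℓ) * (a ∸ b)    ≡⟨ cong (λ d → Σμ + (k ∸ ℓ) * d) (trans (cong (a ∸_) (sym a≡b)) (n∸n≡0 a)) ⟩
      Σμ + (k ∸ ℓ) * 0          ≡⟨ cong (Σμ +_) (*-zeroʳ (k ∸ ℓ)) ⟩
      Σμ + 0                    ≡⟨ +-identityʳ Σμ ⟩
      Σμ                        ∎)
      where open ≡-Reasoning

module Partitions where

  open import Data.Nat
  open import Data.Fin as Fin using (Fin; toℕ)
  open import Relation.Binary.PropositionalEquality
  open import Defs using (sumℕ; psum; IsPartition; DomPair)
  open Sequences

  extend : ∀ {r} → (Fin r → ℕ) → ℕ → ℕ
  extend {zero}  f n       = 0
  extend {suc r} f zero    = f Fin.zero
  extend {suc r} f (suc n) = extend (λ i → f (Fin.suc i)) n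

  extend-∘toℕ : ∀ {r} {F : ℕ → ℕ} → (∀ n → r ≤ n → F n ≡ 0) → ∀ n → extend {r} (λ i → F (toℕ i)) n ≡ F n
  extend-∘toℕ {zero}  F≡0 n       = sym (F≡0 n z≤n)
  extend-∘toℕ {suc r} F≡0 zero    = refl
  extend-∘toℕ {suc r} F≡0 (suc n) = extend-∘toℕ {r} (λ n r≤n → F≡0 (suc n) (s≤s r≤n)) n

  extend-antitone : ∀ {r} (f : Fin r → ℕ) → IsPartition f → Antitone (extend f)
  extend-antitone {zero}        f f↓ n       = z≤n
  extend-antitone {suc zero}    f f↓ zero    = z≤n
  extend-antitone {suc (suc r)} f f↓ zero    = f↓ Fin.zero (Fin.suc Fin.zero) z≤n
  extend-antitone {suc r}       f f↓ (suc n) =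
    extend-antitone (λ i → f (Fin.suc i)) (λ i j i≤j → f↓ (Fin.suc i) (Fin.suc j) (s≤s i≤j)) n

  psum≡Σ<-extend : ∀ {r} (f : Fin r → ℕ) k → psum f k ≡ Σ< k (extend f)
  psum≡Σ<-extend {zero}  f k       = sym (Σ<-zero k (λ _ _ → refl))
  psum≡Σ<-extend {suc r} f zero    = refl
  psum≡Σ<-extend {suc r} f (suc k) = cong (f Fin.zero +_) (psum≡Σ<-extend (λ i → f (Fin.suc i)) k)

  psum-∘toℕ : ∀ {r} (F : ℕ → ℕ) {k} → k ≤ r → psum {r} (λ i → F (toℕ i)) k ≡ Σ< k F
  psum-∘toℕ {zero}  F z≤n       = refl
  psum-∘toℕ {suc r} F {zero} _  = refl
  psum-∘toℕ {suc r} F (s≤s k≤r) = cong (F 0 +_) (psum-∘toℕ (λ n → F (suc n)) k≤r)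

  sumℕ-∘toℕ : ∀ {r} (F : ℕ → ℕ) → sumℕ {r} (λ i → F (toℕ i)) ≡ Σ< r F
  sumℕ-∘toℕ {zero}  F = refl
  sumℕ-∘toℕ {suc r} F = cong (F 0 +_) (sumℕ-∘toℕ {r} (λ n → F (suc n)))

  fromSequences : ∀ {r} (F G : ℕ → ℕ) → Antitone F → Antitone G →
    (∀ k → k ≤ r → Σ< k G ≤ Σ< k F) → Σ< r G ≡ Σ< r F → DomPair r
  fromSequences {r} F G F↓ G↓ dominated balanced = record
    { n    = sumℕ lam
    ; lam  = lam
    ; mu   = mu
    ; lamP = λ i j i≤j → antitone-≤ F↓ i≤j
    ; muP  = λ i j i≤j → antitone-≤ G↓ i≤j
    ; lamN = refl
    ; muN  = trans (sumℕ-∘toℕ {r} G) (trans balanced (sym (sumℕ-∘toℕ {r} F)))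
    ; dom  = λ k k≤r → subst₂ _≤_ (sym (psum-∘toℕ G k≤r)) (sym (psum-∘toℕ F k≤r)) (dominated k k≤r)
    }
    where
    lam mu : Fin r → ℕ
    lam i = F (toℕ i)
    mu  i = G (toℕ i)

module Vertices where

  open import Data.Nat as ℕ using (ℕ; zero; suc; _≤_; _<_; _≡ᵇ_)
  open import Data.Nat.Properties as ℕ using (≡ᵇ⇒≡; ≡⇒≡ᵇ)
  open import Data.Bool using (true; false; T)
  open import Data.Unit using (tt)
  open import Data.Fin as Fin using (Fin; toℕ)
  open import Data.Rational using (ℚ; 1ℚ; _+_; _*_)
  open import Data.Product using (Σ; _×_; _,_)
  open import Data.Sum using (inj₁; inj₂)
  open import Relation.Nullary using (contradiction)
  open import Data.Empty using (⊥-elim)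
  open import Relation.Binary.PropositionalEquality
  open import Defs
  open Embedding
  open Sequences
  open Vectors
  open Rays
  open Partitions

  size : ∀ {r} → Triple → ℕ
  size {r} t = sumℕ {r} (λ i → rλ t (toℕ i)) ℕ.+ sumℕ {r} (λ i → rμ t (toℕ i))

  vertexAt : ∀ {r} → Triple → Point r
  vertexAt {r} t = (λ i → frac (rλ t (toℕ i)) (size {r} t)) , (λ i → frac (rμ t (toℕ i)) (size {r} t))

  triple : ∀ {r} → Label r → Triple
  triple L = Label.a L , Label.b L , rayℓ L

  sumℚ-ℕ→ℚ : ∀ {r} (f : Fin r → ℕ) → sumℚ (λ i → ℕ→ℚ (f i)) ≡ ℕ→ℚ (sumℕ f)
  sumℚ-ℕ→ℚ {zero}  f = refl
  sumℚ-ℕ→ℚ {suc r} f = trans (cong (ℕ→ℚ (f Fin.zero) +_) (sumℚ-ℕ→ℚ (λ i → f (Fin.suc i))))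
    (sym (ℕ→ℚ-homo-+ (f Fin.zero) _))

  total-toPoint : ∀ {r} (p : DomPair r) → total (toPoint p) ≡ ℕ→ℚ (sumℕ (DomPair.lam p) ℕ.+ sumℕ (DomPair.mu p))
  total-toPoint p = trans (cong₂ _+_ (sumℚ-ℕ→ℚ (DomPair.lam p)) (sumℚ-ℕ→ℚ (DomPair.mu p)))
    (sym (ℕ→ℚ-homo-+ (sumℕ (DomPair.lam p)) (sumℕ (DomPair.mu p))))

  module _ {a b ℓ : ℕ} (e : Extremal (a , b , ℓ)) {r : ℕ} (a≤r : a ≤ r) where
    private
      t = (a , b , ℓ)

    rλ-beyond : ∀ n → r ≤ n → rλ t n ≡ 0
    rλ-beyond n r≤n = rλ-≥ {a} {b} {ℓ} (ℕ.≤-trans (extremal-b≤a e) (ℕ.≤-trans a≤r r≤n))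

    rμ-beyond : ∀ n → r ≤ n → rμ t n ≡ 0
    rμ-beyond n r≤n = rμ-≥ {a} {b} (ℕ.<⇒≤ (extremal-ℓ<a e)) (ℕ.≤-trans a≤r r≤n)

    rayPair : DomPair r
    rayPair = fromSequences (rλ t) (rμ t) (rλ-antitone e) (rμ-antitone e)
      (λ k _ → Σ<-rμ≤rλ e k) (Σ<-rμ≡rλ e r (λ (_ , r<a , _) → ℕ.<⇒≱ r<a a≤r))

    private
      ray = toPoint rayPair

    size-suc : size {r} t ≡ suc (ℕ.pred (size {r} t))
    size-suc = sym (ℕ.suc-pred (size {r} t) {{ℕ.>-nonZero positive}})
      where
      0<r : 0 < r
      0<r = ℕ.<-≤-trans (extremal-1≤a e) a≤r
      positive : 0 < size {r} t
      positive = begin-strict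
        0                                   <⟨ ℕ.m<n⇒0<n∸m (extremal-ℓ<a e) ⟩
        a ℕ.∸ ℓ                             ≡⟨ rλ-< {a} {b} {ℓ} (extremal-1≤b e) ⟨
        rλ t 0                              ≤⟨ head≤Σ< (rλ t) 0<r ⟩
        Σ< r (rλ t)                         ≡⟨ sumℕ-∘toℕ {r} (rλ t) ⟨
        sumℕ {r} (λ i → rλ t (toℕ i))       ≤⟨ ℕ.m≤m+n _ _ ⟩
        size {r} t                          ∎
        where open ℕ.≤-Reasoning

    normaliser : ℚ
    normaliser = 1/suc (ℕ.pred (size {r} t))

    vertexAt≈normaliser•ray : vertexAt {r} t ≈ (normaliser • ray)
    vertexAt≈normaliser•ray =
        (λ i → trans (cong (frac (rλ t (toℕ i))) size-suc) (frac-suc (rλ t (toℕ i)) (ℕ.pred (size {r} t))))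
      , (λ i → trans (cong (frac (rμ t (toℕ i))) size-suc) (frac-suc (rμ t (toℕ i)) (ℕ.pred (size {r} t))))

    dot-vertexAt : ∀ c → dot c (vertexAt {r} t) ≡ normaliser * dot c ray
    dot-vertexAt c = trans (dot-congʳ c vertexAt≈normaliser•ray) (dot-•ʳ c normaliser ray)

    normaliser-inverse : normaliser * total ray ≡ 1ℚ
    normaliser-inverse = trans (cong (normaliser *_) (trans (total-toPoint rayPair) (cong ℕ→ℚ size-suc)))
      (1/suc-inverse (ℕ.pred (size {r} t)))

    total-vertexAt : total (vertexAt {r} t) ≡ 1ℚ
    total-vertexAt = trans (total≡dot𝟙 (vertexAt {r} t))
      (trans (dot-vertexAt 𝟙) (trans (cong (normaliser *_) (sym (total≡dot𝟙 ray))) normaliser-inverse))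

  module _ {r : ℕ} (L : Label r) where
    private
      a = Label.a L
      b = Label.b L

    rayℓ-off-diagonal : a ≢ b → rayℓ L ≡ Label.ℓ L
    rayℓ-off-diagonal a≢b with a ≡ᵇ b in eq
    ... | false = refl
    ... | true  = contradiction (≡ᵇ⇒≡ a b (subst T (sym eq) tt)) a≢b

    rayℓ-diagonal : a ≡ b → rayℓ L ≡ 0
    rayℓ-diagonal a≡b with a ≡ᵇ b in eq
    ... | true  = refl
    ... | false = ⊥-elim (subst T eq (≡⇒≡ᵇ a b a≡b))

    label-extremal : Extremal (triple L) × a ≤ r
    label-extremal with Label.valid L
    ... | inj₁ (ℓ<b , b<a , a≤r) =
      subst (λ z → Extremal (a , b , z)) (sym (rayℓ-off-diagonal (≢-sym (ℕ.<⇒≢ b<a)))) (off-diagonal ℓ<b b<a) , a≤r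
    ... | inj₂ (b≡a , _ , 1≤a , a≤r) =
      subst₂ (λ y z → Extremal (a , y , z)) (sym b≡a) (sym (rayℓ-diagonal (sym b≡a))) (diagonal 1≤a) , a≤r

  labelOf : ∀ {r a b ℓ} → Extremal (a , b , ℓ) → a ≤ r → Σ (Label r) λ L → triple L ≡ (a , b , ℓ)
  labelOf {r} {a} {b} {ℓ} (off-diagonal ℓ<b b<a) a≤r =
    L , cong (λ z → a , b , z) (rayℓ-off-diagonal L (≢-sym (ℕ.<⇒≢ b<a)))
    where
    L : Label r
    L = record { a = a ; b = b ; ℓ = ℓ ; valid = inj₁ (ℓ<b , b<a , a≤r) }
  labelOf {r} {a} (diagonal 1≤a) a≤r = L , cong (λ z → a , a , z) (rayℓ-diagonal L refl)
    where
    L : Label r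
    L = record { a = a ; b = a ; ℓ = a ; valid = inj₂ (refl , refl , 1≤a , a≤r) }

module Supports where

  open import Data.Nat
  open import Data.Nat.Properties
  open import Data.Product using (_,_)
  open import Data.Sum using (_⊎_; inj₁; inj₂)
  import Data.Sum as Sum
  open import Relation.Binary.PropositionalEquality
  open Rays

  -- descλ j, descμ j and dom k stand for λ j ≥ λ (1 + j), μ j ≥ μ (1 + j) and Σ_{i<k} μ i ≤ Σ_{i<k} λ i.
  data Facet : Set where
    descλ descμ dom : ℕ → Facet

  dropsλ : Triple → ℕ → Set
  dropsλ (a , b , ℓ) n = n ≡ b

  dropsμ : Triple → ℕ → Set
  dropsμ (a , b , ℓ) n = n ≡ a ⊎ n ≡ ℓ

  -- The facets of the Kostka cone that do not contain the ray of t.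
  Support : Triple → Facet → Set
  Support t (descλ j) = dropsλ t (suc j)
  Support t (descμ j) = dropsμ t (suc j)
  Support t (dom k)   = Gap t k

  _⊆_∪_ : Triple → Triple → Triple → Set
  w ⊆ u ∪ v = ∀ φ → Support w φ → Support u φ ⊎ Support v φ

  ⊆-∪-comm : ∀ {w u v} → w ⊆ u ∪ v → w ⊆ v ∪ u
  ⊆-∪-comm w⊆u∪v φ s = Sum.swap (w⊆u∪v φ s)

  private
    suc-pred′ : ∀ {n} → 1 ≤ n → suc (pred n) ≡ n
    suc-pred′ (s≤s _) = refl

  module _ {x y z : ℕ} {u v : Triple} where
    private
      w = (x , y , z)

    ⊆-∪-intro : (dropsλ u y ⊎ dropsλ v y) → (dropsμ u x ⊎ dropsμ v x) → (1 ≤ z → dropsμ u z ⊎ dropsμ v z) →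
      (∀ k → Gap w k → Gap u k ⊎ Gap v k) → w ⊆ u ∪ v
    ⊆-∪-intro covers-y covers-x covers-z covers-gap = λ where
      (descλ j) j+1≡y        → subst (λ n → dropsλ u n ⊎ dropsλ v n) (sym j+1≡y) covers-y
      (descμ j) (inj₁ j+1≡x) → subst (λ n → dropsμ u n ⊎ dropsμ v n) (sym j+1≡x) covers-x
      (descμ j) (inj₂ j+1≡z) → subst (λ n → dropsμ u n ⊎ dropsμ v n) (sym j+1≡z) (covers-z (subst (1 ≤_) j+1≡z (s≤s z≤n)))
      (dom k)   gap          → covers-gap k gap

    module _ (ew : Extremal w) (w⊆u∪v : w ⊆ u ∪ v) where

      covers-μ : ∀ {n} → 1 ≤ n → dropsμ w n → dropsμ u n ⊎ dropsμ v n
      covers-μ {n} 1≤n drop = subst (λ n → dropsμ u n ⊎ dropsμ v n) (suc-pred′ 1≤n)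
        (w⊆u∪v (descμ (pred n)) (subst (dropsμ w) (sym (suc-pred′ 1≤n)) drop))

      covers-y : dropsλ u y ⊎ dropsλ v y
      covers-y = subst (λ n → dropsλ u n ⊎ dropsλ v n) (suc-pred′ 1≤y) (w⊆u∪v (descλ (pred y)) (suc-pred′ 1≤y))
        where 1≤y = extremal-1≤b ew

      covers-x : dropsμ u x ⊎ dropsμ v x
      covers-x = covers-μ (extremal-1≤a ew) (inj₁ refl)

      covers-z : 1 ≤ z → dropsμ u z ⊎ dropsμ v z
      covers-z 1≤z = covers-μ 1≤z (inj₂ refl)

      covers-gap : ∀ k → Gap w k → Gap u k ⊎ Gap v k
      covers-gap k = w⊆u∪v (dom k)

  covered-a≤ : ∀ {x y z a b ℓ a′ b′ ℓ′ r} → Extremal (x , y , z) → Extremal (a , b , ℓ) → Extremal (a′ , b′ , ℓ′) →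
    a ≤ r → a′ ≤ r → (x , y , z) ⊆ (a , b , ℓ) ∪ (a′ , b′ , ℓ′) → x ≤ r
  covered-a≤ ew eu ev a≤r a′≤r w⊆u∪v with covers-x ew w⊆u∪v
  ... | inj₁ (inj₁ refl) = a≤r
  ... | inj₁ (inj₂ refl) = ≤-trans (<⇒≤ (extremal-ℓ<a eu)) a≤r
  ... | inj₂ (inj₁ refl) = a′≤r
  ... | inj₂ (inj₂ refl) = ≤-trans (<⇒≤ (extremal-ℓ<a ev)) a′≤r

module EdgeConditions where

  open import Data.Nat
  open import Data.Nat.Properties
  open import Data.Product using (_×_; _,_; proj₁; proj₂)
  open import Data.Sum using (_⊎_; inj₁; inj₂)
  import Data.Sum as Sum
  open import Data.Empty using (⊥-elim)
  open import Relation.Nullary using (¬_; Dec; yes; no; contradiction)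
  open import Relation.Nullary.Decidable using (_×-dec_; _⊎-dec_; ¬?)
  open import Relation.Binary.Definitions using (tri<; tri≈; tri>)
  open import Relation.Binary.PropositionalEquality
  open Rays
  open Supports

  DiagonalCondition : ℕ → Triple → Set
  DiagonalCondition a (a′ , b′ , ℓ′) = a′ ≡ b′ ⊎ a ≡ b′ ⊎ a′ ≤ a ⊎ a ≤ ℓ′

  ProperCondition : Triple → Triple → Set
  ProperCondition (a , b , ℓ) (a′ , b′ , ℓ′) =
    ((a ≡ a′ × b ≡ b′) ⊎ (a ≡ a′ × ℓ ≡ ℓ′) ⊎ (b ≡ b′ × ℓ ≡ ℓ′)) ⊎ a′ ≤ ℓ ⊎ a ≤ ℓ′

  Condition : Triple → Triple → Set
  Condition (a , b , ℓ) v = (a ≡ b × DiagonalCondition a v) ⊎ (a ≢ b × ProperCondition (a , b , ℓ) v)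

  ProperCondition-comm : ∀ {u v} → ProperCondition u v → ProperCondition v u
  ProperCondition-comm (inj₁ (inj₁ (a≡a′ , b≡b′)))        = inj₁ (inj₁ (sym a≡a′ , sym b≡b′))
  ProperCondition-comm (inj₁ (inj₂ (inj₁ (a≡a′ , ℓ≡ℓ′)))) = inj₁ (inj₂ (inj₁ (sym a≡a′ , sym ℓ≡ℓ′)))
  ProperCondition-comm (inj₁ (inj₂ (inj₂ (b≡b′ , ℓ≡ℓ′)))) = inj₁ (inj₂ (inj₂ (sym b≡b′ , sym ℓ≡ℓ′)))
  ProperCondition-comm (inj₂ (inj₁ a′≤ℓ))                 = inj₂ (inj₂ a′≤ℓ)
  ProperCondition-comm (inj₂ (inj₂ a≤ℓ′))                 = inj₂ (inj₁ a≤ℓ′)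

  private
    irrefl : ∀ {n} → ¬ n < n
    irrefl = <-irrefl refl

    infixl 5 _<<_ _≤<_ _<≤_
    _<<_ : ∀ {m n o} → m < n → n < o → m < o
    _<<_ = <-trans
    _≤<_ : ∀ {m n o} → m ≤ n → n < o → m < o
    _≤<_ = ≤-<-trans
    _<≤_ : ∀ {m n o} → m < n → n ≤ o → m < o
    _<≤_ = <-≤-trans

    ≡→≤ : ∀ {m n} → m ≡ n → m ≤ n
    ≡→≤ = ≤-reflexive

    ≡→≥ : ∀ {m n} → m ≡ n → n ≤ m
    ≡→≥ m≡n = ≤-reflexive (sym m≡n)

    triple-≡ : ∀ {x y z a b ℓ : ℕ} → x ≡ a → y ≡ b → z ≡ ℓ → (x , y , z) ≡ (a , b , ℓ)
    triple-≡ refl refl refl = refl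

  module BothOffDiagonal {a b ℓ a′ b′ ℓ′ x z : ℕ} (ℓ<b : ℓ < b) (b<a : b < a) (ℓ′<b′ : ℓ′ < b′) (b′<a′ : b′ < a′)
    (z<b : z < b) (b<x : b < x) (w⊆u∪v : (x , b , z) ⊆ (a , b , ℓ) ∪ (a′ , b′ , ℓ′)) where

    private
      u = (a , b , ℓ)
      v = (a′ , b′ , ℓ′)
      w = (x , b , z)
      ew = off-diagonal {x} {b} {z} z<b b<x

      gap-w : ∀ k → z < k → k < x → Gap u k ⊎ Gap v k
      gap-w k z<k k<x = covers-gap ew w⊆u∪v k (z<k , k<x , λ x≡b → irrefl (subst (b <_) x≡b b<x))

      ℓ-in-gap : z < ℓ → ℓ′ < ℓ × ℓ < a′
      ℓ-in-gap z<ℓ with gap-w ℓ z<ℓ (ℓ<b << b<x)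
      ... | inj₁ (ℓ<ℓ , _ , _)     = ⊥-elim (irrefl ℓ<ℓ)
      ... | inj₂ (ℓ′<ℓ , ℓ<a′ , _) = ℓ′<ℓ , ℓ<a′

      ℓ′-in-gap : z < ℓ′ → ℓ′ < x → ℓ < ℓ′ × ℓ′ < a
      ℓ′-in-gap z<ℓ′ ℓ′<x with gap-w ℓ′ z<ℓ′ ℓ′<x
      ... | inj₁ (ℓ<ℓ′ , ℓ′<a , _) = ℓ<ℓ′ , ℓ′<a
      ... | inj₂ (ℓ′<ℓ′ , _ , _)   = ⊥-elim (irrefl ℓ′<ℓ′)

      a-in-gap : a < x → ℓ′ < a × a < a′
      a-in-gap a<x with gap-w a (z<b << b<a) a<x
      ... | inj₁ (_ , a<a , _)     = ⊥-elim (irrefl a<a)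
      ... | inj₂ (ℓ′<a , a<a′ , _) = ℓ′<a , a<a′

      x≡a⊎x≡a′ : x ≢ ℓ′ → x ≡ a ⊎ x ≡ a′
      x≡a⊎x≡a′ x≢ℓ′ with covers-x ew w⊆u∪v
      ... | inj₁ (inj₁ x≡a)  = inj₁ x≡a
      ... | inj₁ (inj₂ x≡ℓ)  = ⊥-elim (irrefl (subst (ℓ <_) x≡ℓ (ℓ<b << b<x)))
      ... | inj₂ (inj₁ x≡a′) = inj₂ x≡a′
      ... | inj₂ (inj₂ x≡ℓ′) = ⊥-elim (x≢ℓ′ x≡ℓ′)

      z≡ℓ : ¬ (ℓ′ < ℓ × ℓ < a′) → (z ≡ a′ → z ≡ ℓ) → (z ≡ ℓ′ → z ≡ ℓ) → z ≡ ℓ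
      z≡ℓ ℓ∉gap-v z≡a′⇒ z≡ℓ′⇒ with z ≟ 0
      ... | yes refl with ℓ ≟ 0
      ...   | yes ℓ≡0 = sym ℓ≡0
      ...   | no ℓ≢0  = ⊥-elim (ℓ∉gap-v (ℓ-in-gap (n≢0⇒n>0 ℓ≢0)))
      z≡ℓ ℓ∉gap-v z≡a′⇒ z≡ℓ′⇒ | no z≢0 with covers-z ew w⊆u∪v (n≢0⇒n>0 z≢0)
      ... | inj₁ (inj₁ z≡a)  = ⊥-elim (irrefl (subst (_< a) z≡a (z<b << b<a)))
      ... | inj₁ (inj₂ z≡ℓ)  = z≡ℓ
      ... | inj₂ (inj₁ z≡a′) = z≡a′⇒ z≡a′
      ... | inj₂ (inj₂ z≡ℓ′) = z≡ℓ′⇒ z≡ℓ′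


    endpoint : ProperCondition u v → w ≡ u ⊎ w ≡ v
    endpoint (inj₁ (inj₁ (refl , refl))) = Sum.map (triple-≡ x≡a refl) (triple-≡ x≡a refl) z≡ℓ⊎z≡ℓ′
      where
      x≡a : x ≡ a
      x≡a = Sum.reduce (x≡a⊎x≡a′ (λ x≡ℓ′ → irrefl (ℓ′<b′ << b<x <≤ ≡→≤ x≡ℓ′)))
      z≡ℓ⊎z≡ℓ′ : z ≡ ℓ ⊎ z ≡ ℓ′
      z≡ℓ⊎z≡ℓ′ with z ≟ 0
      ... | yes refl with ℓ ≟ 0 | ℓ′ ≟ 0
      ...   | yes ℓ≡0 | _        = inj₁ (sym ℓ≡0)
      ...   | no _    | yes ℓ′≡0 = inj₂ (sym ℓ′≡0)
      ...   | no ℓ≢0  | no ℓ′≢0 with ≤-total ℓ ℓ′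
      ...     | inj₁ ℓ≤ℓ′ = ⊥-elim (irrefl (proj₁ (ℓ-in-gap (n≢0⇒n>0 ℓ≢0)) <≤ ℓ≤ℓ′))
      ...     | inj₂ ℓ′≤ℓ = ⊥-elim (irrefl (proj₁ (ℓ′-in-gap (n≢0⇒n>0 ℓ′≢0) (ℓ′<b′ << b<x)) <≤ ℓ′≤ℓ))
      z≡ℓ⊎z≡ℓ′ | no z≢0 with covers-z ew w⊆u∪v (n≢0⇒n>0 z≢0)
      ... | inj₁ (inj₁ z≡a) = ⊥-elim (irrefl (z<b << b<a <≤ ≡→≥ z≡a))
      ... | inj₁ (inj₂ z≡ℓ) = inj₁ z≡ℓ
      ... | inj₂ (inj₁ z≡a) = ⊥-elim (irrefl (z<b << b<a <≤ ≡→≥ z≡a))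
      ... | inj₂ (inj₂ z≡ℓ′) = inj₂ z≡ℓ′
    endpoint (inj₁ (inj₂ (inj₁ (refl , refl)))) = inj₁ (triple-≡ x≡a refl z≡ℓ′)
      where
      x≡a : x ≡ a
      x≡a = Sum.reduce (x≡a⊎x≡a′ (λ x≡ℓ → irrefl (ℓ<b << b<x <≤ ≡→≤ x≡ℓ)))
      z≡ℓ′ : z ≡ ℓ
      z≡ℓ′ = z≡ℓ (λ (ℓ<ℓ , _) → irrefl ℓ<ℓ) (λ z≡a → ⊥-elim (irrefl (z<b << b<a <≤ ≡→≥ z≡a))) (λ e → e)
    endpoint (inj₁ (inj₂ (inj₂ (refl , refl)))) =
      Sum.map (λ x≡a → triple-≡ x≡a refl z≡ℓ′) (λ x≡a′ → triple-≡ x≡a′ refl z≡ℓ′)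
      (x≡a⊎x≡a′ (λ x≡ℓ → irrefl (ℓ<b << b<x <≤ ≡→≤ x≡ℓ)))
      where
      z≡ℓ′ : z ≡ ℓ
      z≡ℓ′ = z≡ℓ (λ (ℓ<ℓ , _) → irrefl ℓ<ℓ) (λ z≡a′ → ⊥-elim (irrefl (z<b << b′<a′ <≤ ≡→≥ z≡a′))) (λ e → e)
    endpoint (inj₂ (inj₁ a′≤ℓ)) = inj₁ (triple-≡ x≡a refl z≡ℓ′)
      where
      x≡a : x ≡ a
      x≡a with x≡a⊎x≡a′ (λ x≡ℓ′ → irrefl (ℓ′<b′ << b′<a′ <≤ a′≤ℓ << ℓ<b << b<x <≤ ≡→≤ x≡ℓ′))
      ... | inj₁ x≡a  = x≡a
      ... | inj₂ x≡a′ = ⊥-elim (irrefl (a′≤ℓ ≤< ℓ<b << b<x <≤ ≡→≤ x≡a′))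
      ℓ≤z : ℓ ≤ z
      ℓ≤z with z <? ℓ
      ... | yes z<ℓ = ⊥-elim (irrefl (proj₂ (ℓ-in-gap z<ℓ) <≤ a′≤ℓ))
      ... | no z≮ℓ  = ≮⇒≥ z≮ℓ
      z≡ℓ′ : z ≡ ℓ
      z≡ℓ′ = z≡ℓ (λ (_ , ℓ<a′) → irrefl (ℓ<a′ <≤ a′≤ℓ))
        (λ z≡a′ → ≤-antisym (≤-trans (≡→≤ z≡a′) a′≤ℓ) ℓ≤z)
        (λ z≡ℓ′ → ⊥-elim (irrefl (ℓ′<b′ << b′<a′ <≤ ≤-trans a′≤ℓ (≤-trans ℓ≤z (≡→≤ z≡ℓ′)))))
    endpoint (inj₂ (inj₂ a≤ℓ′)) = inj₁ (triple-≡ x≡a refl z≡ℓ′)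
      where
      x≤a : x ≤ a
      x≤a with a <? x
      ... | yes a<x = ⊥-elim (irrefl (proj₁ (a-in-gap a<x) <≤ a≤ℓ′))
      ... | no a≮x  = ≮⇒≥ a≮x
      x≡a : x ≡ a
      x≡a with covers-x ew w⊆u∪v
      ... | inj₁ (inj₁ x≡a)  = x≡a
      ... | inj₁ (inj₂ x≡ℓ)  = ⊥-elim (irrefl (ℓ<b << b<x <≤ ≡→≤ x≡ℓ))
      ... | inj₂ (inj₁ x≡a′) = ⊥-elim (irrefl (ℓ′<b′ << b′<a′ <≤ ≡→≥ x≡a′ <≤ x≤a <≤ a≤ℓ′))
      ... | inj₂ (inj₂ x≡ℓ′) = ≤-antisym x≤a (≤-trans a≤ℓ′ (≡→≥ x≡ℓ′))
      z≡ℓ′ : z ≡ ℓ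
      z≡ℓ′ = z≡ℓ (λ (ℓ′<ℓ , _) → irrefl (ℓ′<ℓ << ℓ<b << b<a <≤ a≤ℓ′))
        (λ z≡a′ → ⊥-elim (irrefl (z<b << b<a <≤ a≤ℓ′ << ℓ′<b′ << b′<a′ <≤ ≡→≥ z≡a′)))
        (λ z≡ℓ′ → ⊥-elim (irrefl (z<b << b<a <≤ a≤ℓ′ <≤ ≡→≥ z≡ℓ′)))

  module DiagonalOffDiagonal {a a′ b′ ℓ′ x y z : ℕ} (ℓ′<b′ : ℓ′ < b′) (b′<a′ : b′ < a′)
    (z<y : z < y) (y<x : y < x) (condition : DiagonalCondition a (a′ , b′ , ℓ′))
    (w⊆u∪v : (x , y , z) ⊆ (a , a , 0) ∪ (a′ , b′ , ℓ′)) where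

    private
      ew = off-diagonal {x} {y} {z} z<y y<x


      gap-v : ∀ k → z < k → k < x → ℓ′ < k × k < a′
      gap-v k z<k k<x with covers-gap ew w⊆u∪v k (z<k , k<x , λ x≡y → irrefl (subst (y <_) x≡y y<x))
      ... | inj₁ (_ , _ , a≢a)     = contradiction refl a≢a
      ... | inj₂ (ℓ′<k , k<a′ , _) = ℓ′<k , k<a′

      ℓ′<y = proj₁ (gap-v y z<y y<x)
      y<a′ = proj₂ (gap-v y z<y y<x)

      ℓ′≤z : ℓ′ ≤ z
      ℓ′≤z = ≤-pred (proj₁ (gap-v (suc z) ≤-refl (z<y ≤< y<x)))

      x≤a′ : x ≤ a′
      x≤a′ with a′ <? x
      ... | yes a′<x = ⊥-elim (irrefl (proj₂ (gap-v a′ (z<y << y<a′) a′<x)))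
      ... | no a′≮x  = ≮⇒≥ a′≮x

      condition′ : a ≡ b′ ⊎ a′ ≤ a ⊎ a ≤ ℓ′
      condition′ = drop-a′≡b′ condition
        where
        drop-a′≡b′ : DiagonalCondition a (a′ , b′ , ℓ′) → a ≡ b′ ⊎ a′ ≤ a ⊎ a ≤ ℓ′
        drop-a′≡b′ (inj₁ a′≡b′) = ⊥-elim (irrefl (b′<a′ <≤ ≡→≤ a′≡b′))
        drop-a′≡b′ (inj₂ others) = others

      y≡b′ : y ≡ b′
      y≡b′ with covers-y ew w⊆u∪v | condition′
      ... | inj₂ y≡b′ | _                    = y≡b′
      ... | inj₁ y≡a  | inj₁ a≡b′            = trans y≡a a≡b′
      ... | inj₁ y≡a  | inj₂ (inj₁ a′≤a)     = ⊥-elim (irrefl (y<a′ <≤ a′≤a <≤ ≡→≥ y≡a))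
      ... | inj₁ y≡a  | inj₂ (inj₂ a≤ℓ′)     = ⊥-elim (irrefl (ℓ′<y <≤ ≡→≤ y≡a <≤ a≤ℓ′))

      x≡a′ : x ≡ a′
      x≡a′ with covers-x ew w⊆u∪v
      ... | inj₂ (inj₁ x≡a′) = x≡a′
      ... | inj₂ (inj₂ x≡ℓ′) = ⊥-elim (irrefl (ℓ′<y << y<x <≤ ≡→≤ x≡ℓ′))
      ... | inj₁ (inj₂ x≡0)  = ⊥-elim (n≮0 (z<y << y<x <≤ ≡→≤ x≡0))
      ... | inj₁ (inj₁ x≡a) with condition′
      ...   | inj₁ a≡b′        = ⊥-elim (irrefl (y<x <≤ ≡→≤ (trans x≡a (trans a≡b′ (sym y≡b′)))))
      ...   | inj₂ (inj₁ a′≤a) = ≤-antisym x≤a′ (≤-trans a′≤a (≡→≥ x≡a))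
      ...   | inj₂ (inj₂ a≤ℓ′) = ⊥-elim (irrefl (ℓ′<y << y<x <≤ ≡→≤ x≡a <≤ a≤ℓ′))

      z≡ℓ′ : z ≡ ℓ′
      z≡ℓ′ with z ≟ 0
      ... | yes z≡0 = trans z≡0 (sym (n≤0⇒n≡0 (≤-trans ℓ′≤z (≡→≤ z≡0))))
      ... | no z≢0 with covers-z ew w⊆u∪v (n≢0⇒n>0 z≢0)
      ...   | inj₁ (inj₂ z≡0)  = ⊥-elim (z≢0 z≡0)
      ...   | inj₂ (inj₁ z≡a′) = ⊥-elim (irrefl (z<y << y<a′ <≤ ≡→≥ z≡a′))
      ...   | inj₂ (inj₂ z≡ℓ′) = z≡ℓ′
      ...   | inj₁ (inj₁ z≡a) with condition′
      ...     | inj₁ a≡b′        = ⊥-elim (irrefl (z<y <≤ ≡→≤ (trans y≡b′ (trans (sym a≡b′) (sym z≡a)))))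
      ...     | inj₂ (inj₁ a′≤a) = ⊥-elim (irrefl (z<y << y<a′ <≤ a′≤a <≤ ≡→≥ z≡a))
      ...     | inj₂ (inj₂ a≤ℓ′) = ≤-antisym (≤-trans (≡→≤ z≡a) a≤ℓ′) ℓ′≤z

    endpoint : (x , y , z) ≡ (a′ , b′ , ℓ′)
    endpoint = triple-≡ x≡a′ y≡b′ z≡ℓ′

  private
    proper-b∉dropsμ : ∀ {a b ℓ a′ b′ ℓ′} → ℓ < b → b < a → ℓ′ < b′ → b′ < a′ →
      ProperCondition (a , b , ℓ) (a′ , b′ , ℓ′) → ¬ dropsμ (a′ , b′ , ℓ′) b
    proper-b∉dropsμ ℓ<b b<a ℓ′<b′ b′<a′ (inj₁ (inj₁ (refl , _)))        (inj₁ refl) = irrefl b<a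
    proper-b∉dropsμ ℓ<b b<a ℓ′<b′ b′<a′ (inj₁ (inj₂ (inj₁ (refl , _)))) (inj₁ refl) = irrefl b<a
    proper-b∉dropsμ ℓ<b b<a ℓ′<b′ b′<a′ (inj₁ (inj₂ (inj₂ (refl , _)))) (inj₁ refl) = irrefl b′<a′
    proper-b∉dropsμ ℓ<b b<a ℓ′<b′ b′<a′ (inj₂ (inj₁ a′≤ℓ))              (inj₁ refl) = irrefl (a′≤ℓ ≤< ℓ<b)
    proper-b∉dropsμ ℓ<b b<a ℓ′<b′ b′<a′ (inj₂ (inj₂ a≤ℓ′))              (inj₁ refl) = irrefl (ℓ′<b′ << b′<a′ << b<a <≤ a≤ℓ′)
    proper-b∉dropsμ ℓ<b b<a ℓ′<b′ b′<a′ (inj₁ (inj₁ (_ , refl)))        (inj₂ refl) = irrefl ℓ′<b′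
    proper-b∉dropsμ ℓ<b b<a ℓ′<b′ b′<a′ (inj₁ (inj₂ (inj₁ (_ , refl)))) (inj₂ refl) = irrefl ℓ<b
    proper-b∉dropsμ ℓ<b b<a ℓ′<b′ b′<a′ (inj₁ (inj₂ (inj₂ (refl , _)))) (inj₂ refl) = irrefl ℓ′<b′
    proper-b∉dropsμ ℓ<b b<a ℓ′<b′ b′<a′ (inj₂ (inj₁ a′≤ℓ))              (inj₂ refl) = irrefl (a′≤ℓ ≤< ℓ<b << ℓ′<b′ << b′<a′)
    proper-b∉dropsμ ℓ<b b<a ℓ′<b′ b′<a′ (inj₂ (inj₂ a≤ℓ′))              (inj₂ refl) = irrefl (b<a <≤ a≤ℓ′)

  covered⇒endpoint : ∀ {a b ℓ a′ b′ ℓ′ x y z} →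
    Extremal (a , b , ℓ) → Extremal (a′ , b′ , ℓ′) → Extremal (x , y , z) →
    Condition (a , b , ℓ) (a′ , b′ , ℓ′) → a ∸ b ≤ a′ ∸ b′ →
    (x , y , z) ⊆ (a , b , ℓ) ∪ (a′ , b′ , ℓ′) → (x , y , z) ≡ (a , b , ℓ) ⊎ (x , y , z) ≡ (a′ , b′ , ℓ′)
  covered⇒endpoint {a′ = a′} (off-diagonal _ b<a) (diagonal _) _ _ excess _ =
    ⊥-elim (irrefl (m<n⇒0<n∸m b<a <≤ excess <≤ ≤-reflexive (n∸n≡0 a′)))
  covered⇒endpoint (diagonal _) (diagonal _) ew@(diagonal _) _ _ w⊆u∪v with covers-y ew w⊆u∪v
  ... | inj₁ refl = inj₁ refl
  ... | inj₂ refl = inj₂ refl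
  covered⇒endpoint (diagonal _) (diagonal _) ew@(off-diagonal z<y y<x) _ _ w⊆u∪v
    with covers-gap ew w⊆u∪v _ (z<y , y<x , λ x≡y → irrefl (subst (_ <_) x≡y y<x))
  ... | inj₁ (_ , _ , a≢a) = contradiction refl a≢a
  ... | inj₂ (_ , _ , a≢a) = contradiction refl a≢a
  covered⇒endpoint (diagonal _) (off-diagonal ℓ′<b′ b′<a′) ew@(diagonal 1≤x) _ _ w⊆u∪v with covers-y ew w⊆u∪v
  ... | inj₁ refl = inj₁ refl
  ... | inj₂ refl with covers-x ew w⊆u∪v
  ...   | inj₁ (inj₁ refl) = inj₁ refl
  ...   | inj₁ (inj₂ x≡0)  = ⊥-elim (irrefl (1≤x <≤ ≤-reflexive x≡0))
  ...   | inj₂ (inj₁ x≡a′) = ⊥-elim (irrefl (b′<a′ <≤ ≤-reflexive (sym x≡a′)))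
  ...   | inj₂ (inj₂ x≡ℓ′) = ⊥-elim (irrefl (ℓ′<b′ <≤ ≤-reflexive x≡ℓ′))
  covered⇒endpoint (diagonal _) (off-diagonal ℓ′<b′ b′<a′) (off-diagonal z<y y<x) (inj₁ (_ , condition)) _ w⊆u∪v =
    inj₂ (DiagonalOffDiagonal.endpoint ℓ′<b′ b′<a′ z<y y<x condition w⊆u∪v)
  covered⇒endpoint (diagonal _) (off-diagonal _ _) (off-diagonal _ _) (inj₂ (a≢a , _)) _ _ = contradiction refl a≢a
  covered⇒endpoint (off-diagonal _ b<a) (off-diagonal _ _) _ (inj₁ (a≡b , _)) _ _ = ⊥-elim (irrefl (b<a <≤ ≤-reflexive a≡b))
  covered⇒endpoint (off-diagonal ℓ<b b<a) (off-diagonal ℓ′<b′ b′<a′) ew@(diagonal _) (inj₂ (_ , condition)) _ w⊆u∪v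
    with covers-y ew w⊆u∪v | covers-x ew w⊆u∪v
  ... | inj₁ refl | inj₁ (inj₁ b≡a) = ⊥-elim (irrefl (b<a <≤ ≤-reflexive (sym b≡a)))
  ... | inj₁ refl | inj₁ (inj₂ b≡ℓ) = ⊥-elim (irrefl (ℓ<b <≤ ≤-reflexive b≡ℓ))
  ... | inj₁ refl | inj₂ b∈dropsμ-v = ⊥-elim (proper-b∉dropsμ ℓ<b b<a ℓ′<b′ b′<a′ condition b∈dropsμ-v)
  ... | inj₂ refl | inj₂ (inj₁ b′≡a′) = ⊥-elim (irrefl (b′<a′ <≤ ≤-reflexive (sym b′≡a′)))
  ... | inj₂ refl | inj₂ (inj₂ b′≡ℓ′) = ⊥-elim (irrefl (ℓ′<b′ <≤ ≤-reflexive b′≡ℓ′))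
  ... | inj₂ refl | inj₁ b′∈dropsμ-u =
    ⊥-elim (proper-b∉dropsμ ℓ′<b′ b′<a′ ℓ<b b<a (ProperCondition-comm condition) b′∈dropsμ-u)
  covered⇒endpoint (off-diagonal ℓ<b b<a) (off-diagonal ℓ′<b′ b′<a′) ew@(off-diagonal z<y y<x) (inj₂ (_ , condition)) _ w⊆u∪v
    with covers-y ew w⊆u∪v
  ... | inj₁ refl = BothOffDiagonal.endpoint ℓ<b b<a ℓ′<b′ b′<a′ z<y y<x w⊆u∪v condition
  ... | inj₂ refl = Sum.swap (BothOffDiagonal.endpoint ℓ′<b′ b′<a′ ℓ<b b<a z<y y<x (⊆-∪-comm w⊆u∪v)
                                (ProperCondition-comm condition))

  record Witness (u v : Triple) : Set where
    constructor witness
    field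
      {x y z}  : ℕ
      extremal : Extremal (x , y , z)
      covered  : (x , y , z) ⊆ u ∪ v
      ≢-left   : (x , y , z) ≢ u
      ≢-right  : (x , y , z) ≢ v

  private
    triple-fst : ∀ {x y z a b ℓ : ℕ} → (x , y , z) ≡ (a , b , ℓ) → x ≡ a
    triple-fst refl = refl

    triple-snd : ∀ {x y z a b ℓ : ℕ} → (x , y , z) ≡ (a , b , ℓ) → y ≡ b
    triple-snd refl = refl

    ≢-fst : ∀ {x y z a b ℓ : ℕ} → x ≢ a → (x , y , z) ≢ (a , b , ℓ)
    ≢-fst x≢a refl = x≢a refl

    ≢-snd : ∀ {x y z a b ℓ : ℕ} → y ≢ b → (x , y , z) ≢ (a , b , ℓ)
    ≢-snd y≢b refl = y≢b refl

    ≢-thd : ∀ {x y z a b ℓ : ℕ} → z ≢ ℓ → (x , y , z) ≢ (a , b , ℓ)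
    ≢-thd z≢ℓ refl = z≢ℓ refl

  ¬diagonal⇒witness : ∀ {a a′ b′ ℓ′} → ℓ′ < b′ → b′ < a′ →
    ¬ DiagonalCondition a (a′ , b′ , ℓ′) → Witness (a , a , 0) (a′ , b′ , ℓ′)
  ¬diagonal⇒witness {a} {a′} {b′} {ℓ′} ℓ′<b′ b′<a′ ¬diagonal with <-cmp a b′
  ... | tri≈ _ a≡b′ _ = contradiction (inj₂ (inj₁ a≡b′)) ¬diagonal
  ... | tri< a<b′ _ _ = witness (off-diagonal a<b′ b′<a′)
          (⊆-∪-intro (inj₂ refl) (inj₂ (inj₁ refl)) (λ _ → inj₁ (inj₁ refl))
            (λ k (a<k , k<a′ , _) → inj₂ (ℓ′<a << a<k , k<a′ , >⇒≢ b′<a′)))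
          (≢-fst (>⇒≢ a<a′)) (≢-thd (>⇒≢ ℓ′<a))
    where
    a<a′ = ≰⇒> (λ a′≤a → ¬diagonal (inj₂ (inj₂ (inj₁ a′≤a))))
    ℓ′<a = ≰⇒> (λ a≤ℓ′ → ¬diagonal (inj₂ (inj₂ (inj₂ a≤ℓ′))))
  ... | tri> _ _ b′<a = witness (off-diagonal ℓ′<b′ b′<a)
          (⊆-∪-intro (inj₂ refl) (inj₁ (inj₁ refl)) (λ _ → inj₂ (inj₂ refl))
            (λ k (ℓ′<k , k<a , _) → inj₂ (ℓ′<k , k<a << a<a′ , >⇒≢ b′<a′)))
          (≢-snd (<⇒≢ b′<a)) (≢-fst (<⇒≢ a<a′))
    where
    a<a′ = ≰⇒> (λ a′≤a → ¬diagonal (inj₂ (inj₂ (inj₁ a′≤a))))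

  ¬proper⇒witness : ∀ {a b ℓ a′ b′ ℓ′} → ℓ < b → b < a → ℓ′ < b′ → b′ < a′ →
    ¬ ProperCondition (a , b , ℓ) (a′ , b′ , ℓ′) → Witness (a , b , ℓ) (a′ , b′ , ℓ′)
  ¬proper⇒witness {a} {b} {ℓ} {a′} {b′} {ℓ′} ℓ<b b<a ℓ′<b′ b′<a′ ¬proper = choose (ℓ ≟ ℓ′)
    where
    ℓ<a′ = ≰⇒> (λ a′≤ℓ → ¬proper (inj₂ (inj₁ a′≤ℓ)))
    ℓ′<a = ≰⇒> (λ a≤ℓ′ → ¬proper (inj₂ (inj₂ a≤ℓ′)))
    gap-u : ∀ {k} → ℓ < k → k < a → Gap (a , b , ℓ) k
    gap-u ℓ<k k<a = ℓ<k , k<a , >⇒≢ b<a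
    gap-v : ∀ {k} → ℓ′ < k → k < a′ → Gap (a′ , b′ , ℓ′) k
    gap-v ℓ′<k k<a′ = ℓ′<k , k<a′ , >⇒≢ b′<a′

    choose : Dec (ℓ ≡ ℓ′) → Witness (a , b , ℓ) (a′ , b′ , ℓ′)
    choose (no ℓ≢ℓ′) with ℓ′ <? b
    ... | yes ℓ′<b = witness (off-diagonal ℓ′<b b<a)
          (⊆-∪-intro (inj₁ refl) (inj₁ (inj₁ refl)) (λ _ → inj₂ (inj₂ refl)) gaps-covered)
          (≢-thd (≢-sym ℓ≢ℓ′)) (λ w≡v → ¬proper (inj₁ (inj₁ (triple-fst w≡v , triple-snd w≡v))))
      where
      gaps-covered : ∀ k → Gap (a , b , ℓ′) k → Gap (a , b , ℓ) k ⊎ Gap (a′ , b′ , ℓ′) k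
      gaps-covered k (ℓ′<k , k<a , _) with ℓ <? k
      ... | yes ℓ<k = inj₁ (gap-u ℓ<k k<a)
      ... | no ℓ≮k  = inj₂ (gap-v ℓ′<k (≮⇒≥ ℓ≮k ≤< ℓ<a′))
    ... | no ℓ′≮b = witness (off-diagonal ℓ<b′ b′<a′)
          (⊆-∪-intro (inj₂ refl) (inj₂ (inj₁ refl)) (λ _ → inj₁ (inj₂ refl)) gaps-covered)
          (λ w≡u → ¬proper (inj₁ (inj₁ (sym (triple-fst w≡u) , sym (triple-snd w≡u))))) (≢-thd ℓ≢ℓ′)
      where
      ℓ<b′ = ℓ<b <≤ ≮⇒≥ ℓ′≮b << ℓ′<b′
      gaps-covered : ∀ k → Gap (a′ , b′ , ℓ) k → Gap (a , b , ℓ) k ⊎ Gap (a′ , b′ , ℓ′) k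
      gaps-covered k (ℓ<k , k<a′ , _) with ℓ′ <? k
      ... | yes ℓ′<k = inj₂ (gap-v ℓ′<k k<a′)
      ... | no ℓ′≮k  = inj₁ (gap-u ℓ<k (≮⇒≥ ℓ′≮k ≤< ℓ′<a))
    choose (yes refl) with b′ <? a
    ... | yes b′<a = witness (off-diagonal ℓ′<b′ b′<a)
          (⊆-∪-intro (inj₂ refl) (inj₁ (inj₁ refl)) (λ _ → inj₁ (inj₂ refl)) (λ k (ℓ<k , k<a , _) → inj₁ (gap-u ℓ<k k<a)))
          (≢-snd (λ b′≡b → ¬proper (inj₁ (inj₂ (inj₂ (sym b′≡b , refl))))))
          (≢-fst (λ a≡a′ → ¬proper (inj₁ (inj₂ (inj₁ (a≡a′ , refl))))))
    ... | no b′≮a = witness (off-diagonal ℓ<b b<a′)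
          (⊆-∪-intro (inj₁ refl) (inj₂ (inj₁ refl)) (λ _ → inj₁ (inj₂ refl)) (λ k (ℓ<k , k<a′ , _) → inj₂ (gap-v ℓ<k k<a′)))
          (≢-fst (λ a′≡a → ¬proper (inj₁ (inj₂ (inj₁ (sym a′≡a , refl))))))
          (≢-snd (λ b≡b′ → ¬proper (inj₁ (inj₂ (inj₂ (b≡b′ , refl))))))
      where
      b<a′ = b<a <≤ ≮⇒≥ b′≮a << b′<a′

  ¬condition⇒witness : ∀ {a b ℓ a′ b′ ℓ′} → Extremal (a , b , ℓ) → Extremal (a′ , b′ , ℓ′) →
    ¬ Condition (a , b , ℓ) (a′ , b′ , ℓ′) → a ∸ b ≤ a′ ∸ b′ → Witness (a , b , ℓ) (a′ , b′ , ℓ′)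
  ¬condition⇒witness (diagonal _) (diagonal _) ¬condition _ = contradiction (inj₁ (refl , inj₁ refl)) ¬condition
  ¬condition⇒witness {a′ = a′} (off-diagonal _ b<a) (diagonal _) _ excess =
    ⊥-elim (irrefl (m<n⇒0<n∸m b<a <≤ excess <≤ ≤-reflexive (n∸n≡0 a′)))
  ¬condition⇒witness (diagonal _) (off-diagonal ℓ′<b′ b′<a′) ¬condition _ =
    ¬diagonal⇒witness ℓ′<b′ b′<a′ (λ diagonal → ¬condition (inj₁ (refl , diagonal)))
  ¬condition⇒witness (off-diagonal ℓ<b b<a) (off-diagonal ℓ′<b′ b′<a′) ¬condition _ =
    ¬proper⇒witness ℓ<b b<a ℓ′<b′ b′<a′ (λ proper → ¬condition (inj₂ (>⇒≢ b<a , proper)))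

  condition-refl : ∀ {u} → Extremal u → Condition u u
  condition-refl (off-diagonal _ b<a) = inj₂ (>⇒≢ b<a , inj₁ (inj₁ (refl , refl)))
  condition-refl (diagonal _)         = inj₁ (refl , inj₁ refl)

  condition? : ∀ u v → Dec (Condition u v)
  condition? (a , b , ℓ) (a′ , b′ , ℓ′) =
    (a ≟ b ×-dec (a′ ≟ b′ ⊎-dec a ≟ b′ ⊎-dec a′ ≤? a ⊎-dec a ≤? ℓ′))
    ⊎-dec
    (¬? (a ≟ b) ×-dec ((((a ≟ a′) ×-dec (b ≟ b′)) ⊎-dec ((a ≟ a′) ×-dec (ℓ ≟ ℓ′)) ⊎-dec ((b ≟ b′) ×-dec (ℓ ≟ ℓ′)))
                       ⊎-dec a′ ≤? ℓ ⊎-dec a ≤? ℓ′))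

  -- Label.ℓ and rayℓ differ only on the diagonal (a versus 0), where the condition does not depend on ℓ.
  Condition-respects-ℓ : ∀ {a b ℓ₁ ℓ₂ a′ b′ ℓ₁′ ℓ₂′} → b ≤ a → (a ≢ b → ℓ₁ ≡ ℓ₂) → (a′ ≢ b′ → ℓ₁′ ≡ ℓ₂′) →
    a ∸ b ≤ a′ ∸ b′ → Condition (a , b , ℓ₁) (a′ , b′ , ℓ₁′) → Condition (a , b , ℓ₂) (a′ , b′ , ℓ₂′)
  Condition-respects-ℓ {a = a} {a′ = a′} {b′ = b′} {ℓ₁′ = ℓ₁′} {ℓ₂′ = ℓ₂′} _ _ ℓ′≡ _ (inj₁ (a≡b , condition)) =
    inj₁ (a≡b , respects condition)
    where
    respects : DiagonalCondition a (a′ , b′ , ℓ₁′) → DiagonalCondition a (a′ , b′ , ℓ₂′)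
    respects (inj₁ a′≡b′)                = inj₁ a′≡b′
    respects (inj₂ (inj₁ a≡b′))          = inj₂ (inj₁ a≡b′)
    respects (inj₂ (inj₂ (inj₁ a′≤a)))   = inj₂ (inj₂ (inj₁ a′≤a))
    respects (inj₂ (inj₂ (inj₂ a≤ℓ₁′))) with a′ ≟ b′
    ... | yes a′≡b′ = inj₁ a′≡b′
    ... | no a′≢b′  = inj₂ (inj₂ (inj₂ (subst (a ≤_) (ℓ′≡ a′≢b′) a≤ℓ₁′)))
  Condition-respects-ℓ {a} {b} {a′ = a′} {b′} b≤a ℓ≡ ℓ′≡ excess (inj₂ (a≢b , condition)) =
    inj₂ (a≢b , subst₂ (λ l l′ → ProperCondition (a , b , l) (a′ , b′ , l′)) (ℓ≡ a≢b) (ℓ′≡ a′≢b′) condition)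
    where
    a′≢b′ : a′ ≢ b′
    a′≢b′ refl = a≢b (≤-antisym (m∸n≡0⇒m≤n (n≤0⇒n≡0 (≤-trans excess (≤-reflexive (n∸n≡0 a′))))) b≤a)

module Slacks where

  open import Data.Nat as ℕ using (ℕ; zero; suc; _∸_; _≤_; _<_; _≡ᵇ_)
  import Data.Nat.Properties as ℕ
  open import Data.Bool using (Bool; true; false; if_then_else_; T)
  open import Data.Unit using (tt)
  open import Data.Product using (_×_; _,_; proj₁; proj₂)
  import Data.Sum as Sum
  open import Data.Sum using (_⊎_; inj₁; inj₂)
  open import Function.Bundles using (_⇔_; mk⇔; Equivalence)
  open import Relation.Nullary using (¬_; Dec; yes; no; contradiction)
  open import Relation.Nullary.Decidable using (_×-dec_; ¬?)
  open import Relation.Binary.PropositionalEquality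
  open import Defs using (DomPair)
  open Sequences
  open Rays
  open Partitions
  open Supports

  Sequences² : Set
  Sequences² = (ℕ → ℕ) × (ℕ → ℕ)

  slack : Facet → Sequences² → ℕ
  slack (descλ j) (F , G) = F j ∸ F (suc j)
  slack (descμ j) (F , G) = G j ∸ G (suc j)
  slack (dom k)   (F , G) = Σ< k F ∸ Σ< k G

  index : Facet → ℕ
  index (descλ j) = j
  index (descμ j) = j
  index (dom k)   = k

  ray : Triple → Sequences²
  ray t = rλ t , rμ t

  private
    ≡⇒∸≡0 : ∀ {m n} → m ≡ n → n ∸ m ≡ 0
    ≡⇒∸≡0 {m} refl = ℕ.n∸n≡0 m

    no-slack : ∀ {m n} → m ≡ n → ¬ (0 < n ∸ m)
    no-slack m≡n 0<n∸m = ℕ.<⇒≢ 0<n∸m (sym (≡⇒∸≡0 m≡n))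

  gap? : ∀ t k → Dec (Gap t k)
  gap? (a , b , ℓ) k = (ℓ ℕ.<? k) ×-dec (k ℕ.<? a) ×-dec ¬? (a ℕ.≟ b)

  slack-ray-positive⇔Support : ∀ {t} → Extremal t → ∀ φ → 0 < slack φ (ray t) ⇔ Support t φ
  slack-ray-positive⇔Support {a , b , ℓ} e (descλ j) = mk⇔ to (λ j+1≡b → ℕ.m<n⇒0<n∸m (rλ-drop j e j+1≡b))
    where
    to : 0 < rλ (a , b , ℓ) j ∸ rλ (a , b , ℓ) (suc j) → suc j ≡ b
    to pos with suc j ℕ.≟ b
    ... | yes j+1≡b = j+1≡b
    ... | no  j+1≢b = contradiction pos (no-slack (rλ-flat {a} {b} {ℓ} j j+1≢b))
  slack-ray-positive⇔Support {a , b , ℓ} e (descμ j) = mk⇔ to (λ drop → ℕ.m<n⇒0<n∸m (rμ-drop j e drop))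
    where
    to : 0 < rμ (a , b , ℓ) j ∸ rμ (a , b , ℓ) (suc j) → suc j ≡ a ⊎ suc j ≡ ℓ
    to pos with suc j ℕ.≟ a | suc j ℕ.≟ ℓ
    ... | yes j+1≡a | _         = inj₁ j+1≡a
    ... | no  _     | yes j+1≡ℓ = inj₂ j+1≡ℓ
    ... | no  j+1≢a | no  j+1≢ℓ =
      contradiction pos (no-slack (rμ-flat {a} {b} {ℓ} j (ℕ.<⇒≤ (extremal-ℓ<a e)) j+1≢a j+1≢ℓ))
  slack-ray-positive⇔Support {t} e (dom k) = mk⇔ to (λ gap → ℕ.m<n⇒0<n∸m (Σ<-rμ<rλ e k gap))
    where
    to : 0 < Σ< k (rλ t) ∸ Σ< k (rμ t) → Gap t k
    to pos with gap? t k
    ... | yes gap = gap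
    ... | no ¬gap = contradiction pos (no-slack (Σ<-rμ≡rλ e k ¬gap))

  ΣFacets : ℕ → (Facet → ℕ) → ℕ
  ΣFacets r g = Σ< r (λ j → g (descλ j)) ℕ.+ Σ< r (λ j → g (descμ j)) ℕ.+ Σ< r (λ k → g (dom k))

  ΣFacets-zero : ∀ r g → (∀ φ → index φ < r → g φ ≡ 0) → ΣFacets r g ≡ 0
  ΣFacets-zero r g g≡0 = cong₂ ℕ._+_
    (cong₂ ℕ._+_ (Σ<-zero r (λ j → g≡0 (descλ j))) (Σ<-zero r (λ j → g≡0 (descμ j))))
    (Σ<-zero r (λ k → g≡0 (dom k)))

  ΣFacets≡0⇒ : ∀ r g → ΣFacets r g ≡ 0 → ∀ φ → index φ < r → g φ ≡ 0
  ΣFacets≡0⇒ r g Σ≡0 φ = go φ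
    where
    Sλ = Σ< r (λ j → g (descλ j))
    Sμ = Σ< r (λ j → g (descμ j))
    go : ∀ φ → index φ < r → g φ ≡ 0
    go (descλ j) = Σ<≡0⇒ r (ℕ.m+n≡0⇒m≡0 Sλ (ℕ.m+n≡0⇒m≡0 (Sλ ℕ.+ Sμ) Σ≡0)) j
    go (descμ j) = Σ<≡0⇒ r (ℕ.m+n≡0⇒n≡0 Sλ (ℕ.m+n≡0⇒m≡0 (Sλ ℕ.+ Sμ) Σ≡0)) j
    go (dom k)   = Σ<≡0⇒ r (ℕ.m+n≡0⇒n≡0 (Sλ ℕ.+ Sμ) Σ≡0) k

  support-index< : ∀ {x y z r} → Extremal (x , y , z) → x ≤ r → ∀ φ → Support (x , y , z) φ → index φ < r
  support-index< e x≤r (descλ j) refl        = ℕ.≤-trans (extremal-b≤a e) x≤r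
  support-index< e x≤r (descμ j) (inj₁ refl) = x≤r
  support-index< e x≤r (descμ j) (inj₂ refl) = ℕ.≤-trans (ℕ.<⇒≤ (extremal-ℓ<a e)) x≤r
  support-index< e x≤r (dom k) (_ , k<x , _) = ℕ.<-≤-trans k<x x≤r

  tight : Triple → Triple → Facet → Bool
  tight u v φ = slack φ (ray u) ℕ.+ slack φ (ray v) ≡ᵇ 0

  faceSlack : ℕ → Triple → Triple → Sequences² → ℕ
  faceSlack r u v s = ΣFacets r (λ φ → if tight u v φ then slack φ s else 0)

  module _ (r : ℕ) (u v : Triple) where

    private
      tight⇒slack≡0 : ∀ φ → tight u v φ ≡ true → slack φ (ray u) ≡ 0 × slack φ (ray v) ≡ 0
      tight⇒slack≡0 φ eq = ℕ.m+n≡0⇒m≡0 _ sum≡0 , ℕ.m+n≡0⇒n≡0 _ sum≡0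
        where sum≡0 = ℕ.≡ᵇ⇒≡ _ 0 (subst T (sym eq) tt)

    faceSlack-left : faceSlack r u v (ray u) ≡ 0
    faceSlack-left = ΣFacets-zero r _ term≡0
      where
      term≡0 : ∀ φ → index φ < r → (if tight u v φ then slack φ (ray u) else 0) ≡ 0
      term≡0 φ _ with tight u v φ in eq
      ... | true  = proj₁ (tight⇒slack≡0 φ eq)
      ... | false = refl

    faceSlack-right : faceSlack r u v (ray v) ≡ 0
    faceSlack-right = ΣFacets-zero r _ term≡0
      where
      term≡0 : ∀ φ → index φ < r → (if tight u v φ then slack φ (ray v) else 0) ≡ 0
      term≡0 φ _ with tight u v φ in eq
      ... | true  = proj₂ (tight⇒slack≡0 φ eq)
      ... | false = refl

    faceSlack≡0⇒⊆ : Extremal u → Extremal v → ∀ {x y z} → Extremal (x , y , z) → x ≤ r →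
      faceSlack r u v (ray (x , y , z)) ≡ 0 → (x , y , z) ⊆ u ∪ v
    faceSlack≡0⇒⊆ eu ev {x} {y} {z} ew x≤r Σ≡0 φ support =
      Sum.map (Equivalence.to (slack-ray-positive⇔Support eu φ)) (Equivalence.to (slack-ray-positive⇔Support ev φ))
        (some-positive (slack φ (ray u)) (slack φ (ray v)) not-tight)
      where
      w = (x , y , z)
      term≡0 : (if tight u v φ then slack φ (ray w) else 0) ≡ 0
      term≡0 = ΣFacets≡0⇒ r (λ ψ → if tight u v ψ then slack ψ (ray w) else 0) Σ≡0 φ (support-index< ew x≤r φ support)
      not-tight : tight u v φ ≡ false
      not-tight with tight u v φ | term≡0
      ... | true  | slack≡0 = contradiction slack≡0 (ℕ.>⇒≢ (Equivalence.from (slack-ray-positive⇔Support ew φ) support))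
      ... | false | _       = refl
      some-positive : ∀ m n → (m ℕ.+ n ≡ᵇ 0) ≡ false → 0 < m ⊎ 0 < n
      some-positive zero    zero    ()
      some-positive zero    (suc n) _ = inj₂ ℕ.z<s
      some-positive (suc m) n       _ = inj₁ ℕ.z<s

  slack-cong : ∀ {F G F′ G′ : ℕ → ℕ} → (∀ n → F n ≡ F′ n) → (∀ n → G n ≡ G′ n) →
    ∀ φ → slack φ (F , G) ≡ slack φ (F′ , G′)
  slack-cong F≗F′ G≗G′ (descλ j) = cong₂ _∸_ (F≗F′ j) (F≗F′ (suc j))
  slack-cong F≗F′ G≗G′ (descμ j) = cong₂ _∸_ (G≗G′ j) (G≗G′ (suc j))
  slack-cong F≗F′ G≗G′ (dom k)   = cong₂ _∸_ (Σ<-cong k (λ n _ → F≗F′ n)) (Σ<-cong k (λ n _ → G≗G′ n))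

  sequences : ∀ {r} → DomPair r → Sequences²
  sequences p = extend (DomPair.lam p) , extend (DomPair.mu p)

module FaceNormals where

  open import Data.Nat as ℕ using (ℕ; zero; suc; _∸_; _≤_; _<_; _<ᵇ_; _≡ᵇ_)
  import Data.Nat.Properties as ℕ
  open import Data.Bool using (Bool; true; false; if_then_else_)
  open import Data.Fin as Fin using (Fin; toℕ)
  open import Data.Rational using (ℚ; 0ℚ; 1ℚ; -_; _+_; _-_; _*_)
  import Data.Rational.Properties as ℚ
  open import Data.Product using (_,_; proj₁; proj₂)
  open import Relation.Binary.PropositionalEquality
  open import Defs using (Point; DomPair; dot; toPoint; ℕ→ℚ; sumℚ; psum)
  open import Tactic.RingSolver using (solve-∀)
  open RationalRing
  open Embedding
  open Sequences
  open Vectors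
  open Rays
  open Partitions
  open Supports
  open Slacks

  δ : Bool → ℚ
  δ true  = 1ℚ
  δ false = 0ℚ

  module _ {r : ℕ} where

    inλ inμ : (Fin r → ℚ) → Point r
    inλ f = f , (λ _ → 0ℚ)
    inμ f = (λ _ → 0ℚ) , f

    dot-inλ : ∀ f (x : Point r) → dot (inλ f) x ≡ sumℚ (λ i → f i * proj₁ x i)
    dot-inλ f x = trans (cong (sumℚ (λ i → f i * proj₁ x i) +_) (sumℚ-0* (proj₂ x))) (ℚ.+-identityʳ _)

    dot-inμ : ∀ f (x : Point r) → dot (inμ f) x ≡ sumℚ (λ i → f i * proj₂ x i)
    dot-inμ f x = trans (cong (_+ sumℚ (λ i → f i * proj₂ x i)) (sumℚ-0* (proj₁ x))) (ℚ.+-identityˡ _)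

    unit prefix : ℕ → Fin r → ℚ
    unit j i   = δ (toℕ i ≡ᵇ j)
    prefix k i = δ (toℕ i <ᵇ k)

  sumℚ-unit : ∀ {r} j (f : Fin r → ℕ) → sumℚ (λ i → unit j i * ℕ→ℚ (f i)) ≡ ℕ→ℚ (extend f j)
  sumℚ-unit {zero}  j       f = refl
  sumℚ-unit {suc r} zero    f = begin
    1ℚ * ℕ→ℚ (f Fin.zero) + sumℚ (λ i → 0ℚ * ℕ→ℚ (f (Fin.suc i)))
      ≡⟨ cong₂ _+_ (ℚ.*-identityˡ (ℕ→ℚ (f Fin.zero))) (sumℚ-0* (λ i → ℕ→ℚ (f (Fin.suc i)))) ⟩
    ℕ→ℚ (f Fin.zero) + 0ℚ  ≡⟨ ℚ.+-identityʳ _ ⟩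
    ℕ→ℚ (f Fin.zero)       ∎
    where open ≡-Reasoning
  sumℚ-unit {suc r} (suc j) f = begin
    0ℚ * ℕ→ℚ (f Fin.zero) + sumℚ (λ i → unit j i * ℕ→ℚ (f (Fin.suc i)))
      ≡⟨ cong₂ _+_ (ℚ.*-zeroˡ (ℕ→ℚ (f Fin.zero))) (sumℚ-unit j (λ i → f (Fin.suc i))) ⟩
    0ℚ + ℕ→ℚ (extend (λ i → f (Fin.suc i)) j)  ≡⟨ ℚ.+-identityˡ _ ⟩
    ℕ→ℚ (extend f (suc j))                     ∎
    where open ≡-Reasoning

  sumℚ-prefix : ∀ {r} k (f : Fin r → ℕ) → sumℚ (λ i → prefix k i * ℕ→ℚ (f i)) ≡ ℕ→ℚ (psum f k)
  sumℚ-prefix {zero}  k       f = refl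
  sumℚ-prefix {suc r} zero    f = begin
    0ℚ * ℕ→ℚ (f Fin.zero) + sumℚ (λ i → 0ℚ * ℕ→ℚ (f (Fin.suc i)))
      ≡⟨ cong₂ _+_ (ℚ.*-zeroˡ (ℕ→ℚ (f Fin.zero))) (sumℚ-0* (λ i → ℕ→ℚ (f (Fin.suc i)))) ⟩
    0ℚ + 0ℚ  ≡⟨ ℚ.+-identityʳ 0ℚ ⟩
    0ℚ       ∎
    where open ≡-Reasoning
  sumℚ-prefix {suc r} (suc k) f = begin
    1ℚ * ℕ→ℚ (f Fin.zero) + sumℚ (λ i → prefix k i * ℕ→ℚ (f (Fin.suc i)))
      ≡⟨ cong₂ _+_ (ℚ.*-identityˡ (ℕ→ℚ (f Fin.zero))) (sumℚ-prefix k (λ i → f (Fin.suc i))) ⟩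
    ℕ→ℚ (f Fin.zero) + ℕ→ℚ (psum (λ i → f (Fin.suc i)) k)  ≡⟨ ℕ→ℚ-homo-+ (f Fin.zero) _ ⟨
    ℕ→ℚ (psum f (suc k))                                   ∎
    where open ≡-Reasoning

  outerNormal : ∀ {r} → Facet → Point r
  outerNormal (descλ j) = inλ (unit (suc j)) ⊖ inλ (unit j)
  outerNormal (descμ j) = inμ (unit (suc j)) ⊖ inμ (unit j)
  outerNormal (dom k)   = inμ (prefix k) ⊖ inλ (prefix k)

  private
    ℕ→ℚ-difference : ∀ {m n} → n ≤ m → ℕ→ℚ n - ℕ→ℚ m ≡ - ℕ→ℚ (m ∸ n)
    ℕ→ℚ-difference {m} {n} n≤m = trans (swap (ℕ→ℚ n) (ℕ→ℚ m)) (cong -_ (sym (ℕ→ℚ-homo-∸ n≤m)))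
      where
      swap : ∀ a b → a - b ≡ - (b - a)
      swap = solve-∀ ℚ-ring

  dot-outerNormal : ∀ {r} (p : DomPair r) φ → index φ < r → dot (outerNormal φ) (toPoint p) ≡ - ℕ→ℚ (slack φ (sequences p))
  dot-outerNormal p (descλ j) _ = begin
    dot (inλ (unit (suc j)) ⊖ inλ (unit j)) (toPoint p)
      ≡⟨ dot-⊖ˡ (inλ (unit (suc j))) (inλ (unit j)) (toPoint p) ⟩
    dot (inλ (unit (suc j))) (toPoint p) - dot (inλ (unit j)) (toPoint p)
      ≡⟨ cong₂ _-_ (trans (dot-inλ (unit (suc j)) (toPoint p)) (sumℚ-unit (suc j) lam))
                   (trans (dot-inλ (unit j) (toPoint p)) (sumℚ-unit j lam)) ⟩
    ℕ→ℚ (extend lam (suc j)) - ℕ→ℚ (extend lam j)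
      ≡⟨ ℕ→ℚ-difference (extend-antitone lam (DomPair.lamP p) j) ⟩
    - ℕ→ℚ (extend lam j ∸ extend lam (suc j)) ∎
    where
    open ≡-Reasoning
    lam = DomPair.lam p
  dot-outerNormal p (descμ j) _ = begin
    dot (inμ (unit (suc j)) ⊖ inμ (unit j)) (toPoint p)
      ≡⟨ dot-⊖ˡ (inμ (unit (suc j))) (inμ (unit j)) (toPoint p) ⟩
    dot (inμ (unit (suc j))) (toPoint p) - dot (inμ (unit j)) (toPoint p)
      ≡⟨ cong₂ _-_ (trans (dot-inμ (unit (suc j)) (toPoint p)) (sumℚ-unit (suc j) mu))
                   (trans (dot-inμ (unit j) (toPoint p)) (sumℚ-unit j mu)) ⟩
    ℕ→ℚ (extend mu (suc j)) - ℕ→ℚ (extend mu j)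
      ≡⟨ ℕ→ℚ-difference (extend-antitone mu (DomPair.muP p) j) ⟩
    - ℕ→ℚ (extend mu j ∸ extend mu (suc j)) ∎
    where
    open ≡-Reasoning
    mu = DomPair.mu p
  dot-outerNormal p (dom k) k<r = begin
    dot (inμ (prefix k) ⊖ inλ (prefix k)) (toPoint p)
      ≡⟨ dot-⊖ˡ (inμ (prefix k)) (inλ (prefix k)) (toPoint p) ⟩
    dot (inμ (prefix k)) (toPoint p) - dot (inλ (prefix k)) (toPoint p)
      ≡⟨ cong₂ _-_ (trans (dot-inμ (prefix k) (toPoint p)) (sumℚ-prefix k mu))
                   (trans (dot-inλ (prefix k) (toPoint p)) (sumℚ-prefix k lam)) ⟩
    ℕ→ℚ (psum mu k) - ℕ→ℚ (psum lam k)
      ≡⟨ ℕ→ℚ-difference (DomPair.dom p k (ℕ.<⇒≤ k<r)) ⟩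
    - ℕ→ℚ (psum lam k ∸ psum mu k)
      ≡⟨ cong (λ n → - ℕ→ℚ n) (cong₂ _∸_ (psum≡Σ<-extend lam k) (psum≡Σ<-extend mu k)) ⟩
    - ℕ→ℚ (Σ< k (extend lam) ∸ Σ< k (extend mu)) ∎
    where
    open ≡-Reasoning
    lam = DomPair.lam p
    mu  = DomPair.mu p

  private
    neg-ℕ→ℚ-homo-+ : ∀ m n → - ℕ→ℚ m + - ℕ→ℚ n ≡ - ℕ→ℚ (m ℕ.+ n)
    neg-ℕ→ℚ-homo-+ m n = trans (sym (ℚ.neg-distrib-+ (ℕ→ℚ m) (ℕ→ℚ n))) (cong -_ (sym (ℕ→ℚ-homo-+ m n)))

  ∑ᵥ : ∀ {r} → ℕ → (ℕ → Point r) → Point r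
  ∑ᵥ zero    V = 0ᵥ
  ∑ᵥ (suc k) V = V 0 ⊕ ∑ᵥ k (λ n → V (suc n))

  dot-∑ᵥ : ∀ {r} k V G (x : Point r) → (∀ n → n < k → dot (V n) x ≡ - ℕ→ℚ (G n)) →
    dot (∑ᵥ k V) x ≡ - ℕ→ℚ (Σ< k G)
  dot-∑ᵥ zero    V G x _     = dot-0ˡ x
  dot-∑ᵥ (suc k) V G x dot≡ = begin
    dot (V 0 ⊕ ∑ᵥ k (λ n → V (suc n))) x
      ≡⟨ dot-⊕ˡ (V 0) (∑ᵥ k (λ n → V (suc n))) x ⟩
    dot (V 0) x + dot (∑ᵥ k (λ n → V (suc n))) x
      ≡⟨ cong₂ _+_ (dot≡ 0 ℕ.z<s) (dot-∑ᵥ k (λ n → V (suc n)) (λ n → G (suc n)) x (λ n n<k → dot≡ (suc n) (ℕ.s<s n<k))) ⟩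
    - ℕ→ℚ (G 0) + - ℕ→ℚ (Σ< k (λ n → G (suc n)))
      ≡⟨ neg-ℕ→ℚ-homo-+ (G 0) _ ⟩
    - ℕ→ℚ (Σ< (suc k) G) ∎
    where open ≡-Reasoning

  ∑Facetsᵥ : ∀ {r} → ℕ → (Facet → Point r) → Point r
  ∑Facetsᵥ k V = ∑ᵥ k (λ j → V (descλ j)) ⊕ ∑ᵥ k (λ j → V (descμ j)) ⊕ ∑ᵥ k (λ k → V (dom k))

  dot-∑Facetsᵥ : ∀ {r} k V g (x : Point r) → (∀ φ → index φ < k → dot (V φ) x ≡ - ℕ→ℚ (g φ)) →
    dot (∑Facetsᵥ k V) x ≡ - ℕ→ℚ (ΣFacets k g)
  dot-∑Facetsᵥ k V g x dot≡ = begin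
    dot (Vλ ⊕ Vμ ⊕ Vd) x                ≡⟨ dot-⊕ˡ (Vλ ⊕ Vμ) Vd x ⟩
    dot (Vλ ⊕ Vμ) x + dot Vd x          ≡⟨ cong (_+ dot Vd x) (dot-⊕ˡ Vλ Vμ x) ⟩
    dot Vλ x + dot Vμ x + dot Vd x
      ≡⟨ cong₂ _+_ (cong₂ _+_ (dot-∑ᵥ k (λ j → V (descλ j)) (λ j → g (descλ j)) x (λ j → dot≡ (descλ j)))
                               (dot-∑ᵥ k (λ j → V (descμ j)) (λ j → g (descμ j)) x (λ j → dot≡ (descμ j))))
                   (dot-∑ᵥ k (λ j → V (dom j)) (λ j → g (dom j)) x (λ j → dot≡ (dom j))) ⟩
    - ℕ→ℚ Gλ + - ℕ→ℚ Gμ + - ℕ→ℚ Gd     ≡⟨ cong (_+ - ℕ→ℚ Gd) (neg-ℕ→ℚ-homo-+ Gλ Gμ) ⟩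
    - ℕ→ℚ (Gλ ℕ.+ Gμ) + - ℕ→ℚ Gd        ≡⟨ neg-ℕ→ℚ-homo-+ (Gλ ℕ.+ Gμ) Gd ⟩
    - ℕ→ℚ (ΣFacets k g)                 ∎
    where
    open ≡-Reasoning
    Vλ = ∑ᵥ k (λ j → V (descλ j))
    Vμ = ∑ᵥ k (λ j → V (descμ j))
    Vd = ∑ᵥ k (λ j → V (dom j))
    Gλ = Σ< k (λ j → g (descλ j))
    Gμ = Σ< k (λ j → g (descμ j))
    Gd = Σ< k (λ j → g (dom j))

  faceNormal : ∀ {r} → Triple → Triple → Point r
  faceNormal {r} u v = ∑Facetsᵥ r (λ φ → if tight u v φ then outerNormal φ else 0ᵥ)

  dot-faceNormal : ∀ {r} u v (p : DomPair r) s → (∀ φ → slack φ (sequences p) ≡ slack φ s) →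
    dot (faceNormal u v) (toPoint p) ≡ - ℕ→ℚ (faceSlack r u v s)
  dot-faceNormal {r} u v p s slack≡ = dot-∑Facetsᵥ r (λ φ → if tight u v φ then outerNormal φ else 0ᵥ)
    (λ φ → if tight u v φ then slack φ s else 0) (toPoint p) term
    where
    term : ∀ φ → index φ < r →
      dot (if tight u v φ then outerNormal φ else 0ᵥ) (toPoint p) ≡ - ℕ→ℚ (if tight u v φ then slack φ s else 0)
    term φ φ<r with tight u v φ
    ... | true  = trans (dot-outerNormal p φ φ<r) (cong (λ n → - ℕ→ℚ n) (slack≡ φ))
    ... | false = dot-0ˡ (toPoint p)

module Cone where

  open import Data.Nat as ℕ using (ℕ; zero; suc)
  import Data.Nat.Properties as ℕ
  open import Data.Fin as Fin using (Fin)
  open import Data.Rational as ℚ using (ℚ; 0ℚ; 1ℚ; -_; _+_; _-_; _*_; _≤_)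
  import Data.Rational.Properties as ℚ
  open import Data.Product using (_,_; proj₁; proj₂)
  open import Data.List using (List; []; _∷_)
  open import Data.List.Relation.Unary.All using (All; []; _∷_)
  open import Relation.Binary.PropositionalEquality
  open import Defs
  open import Tactic.RingSolver using (solve-∀)
  open RationalRing
  open Embedding
  open Vectors
  open Partitions using (fromSequences)
  open Vertices using (total-toPoint)

  module _ {r : ℕ} (c : Point r) (nonpositive : ∀ (p : DomPair r) → dot c (toPoint p) ≤ 0ℚ) where

    dot-combo-≤0 : ∀ ps → All (λ q → 0ℚ ≤ proj₁ q) ps → dot c (combo ps) ≤ 0ℚ
    dot-combo-≤0 []             []          = ℚ.≤-reflexive (dot-0ʳ c)
    dot-combo-≤0 ((q , p) ∷ ps) (0≤q ∷ 0≤ps) = begin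
      dot c (q • toPoint p ⊕ combo ps)         ≡⟨ dot-⊕ʳ c (q • toPoint p) (combo ps) ⟩
      dot c (q • toPoint p) + dot c (combo ps) ≡⟨ cong (_+ dot c (combo ps)) (dot-•ʳ c q (toPoint p)) ⟩
      q * dot c (toPoint p) + dot c (combo ps) ≤⟨ ℚ.+-mono-≤ (ℚ.*-monoˡ-≤-nonNeg q {{ℚ.nonNegative 0≤q}} (nonpositive p))
                                                              (dot-combo-≤0 ps 0≤ps) ⟩
      q * 0ℚ + 0ℚ                              ≡⟨ cong (_+ 0ℚ) (ℚ.*-zeroʳ q) ⟩
      0ℚ                                       ∎
      where open ℚ.≤-Reasoning

    polytope-≤0 : ∀ x → InKostkaPolytope x → dot c x ≤ 0ℚ
    polytope-≤0 x ((ps , 0≤ps , _ , x≈combo) , _) = ℚ.≤-trans (ℚ.≤-reflexive (dot-congʳ c x≈combo)) (dot-combo-≤0 ps 0≤ps)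

  zeroPair : ∀ {r} → DomPair r
  zeroPair = fromSequences (λ _ → 0) (λ _ → 0) (λ _ → ℕ.z≤n) (λ _ → ℕ.z≤n) (λ _ _ → ℕ.≤-refl) refl

  private
    sumℕ≡0⇒ : ∀ {r} (f : Fin r → ℕ) → sumℕ f ≡ 0 → ∀ i → f i ≡ 0
    sumℕ≡0⇒ {suc r} f sum≡0 Fin.zero    = ℕ.m+n≡0⇒m≡0 (f Fin.zero) sum≡0
    sumℕ≡0⇒ {suc r} f sum≡0 (Fin.suc i) = sumℕ≡0⇒ (λ i → f (Fin.suc i)) (ℕ.m+n≡0⇒n≡0 (f Fin.zero) sum≡0) i

  -- A pair of total size 1 + m, scaled by 1/(1 + m), is the convex combination of itself and the zero pair.
  scaled-∈-polytope : ∀ {r} (p : DomPair r) m → total (toPoint p) ≡ ℕ→ℚ (suc m) → InKostkaPolytope (1/suc m • toPoint p)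
  scaled-∈-polytope p m total≡ =
    ( ((t , p) ∷ (1ℚ - t , zeroPair) ∷ [])
    , (0≤t ∷ 0≤1-t ∷ [])
    , coefficients t
    , ((λ i → padding t (proj₁ (toPoint p) i)) , (λ i → padding t (proj₂ (toPoint p) i))) )
    , total-scaled
    where
    t = 1/suc m
    0≤t : 0ℚ ≤ t
    0≤t = ℚ.<⇒≤ (1/suc-positive m)
    t≤1 : t ≤ 1ℚ
    t≤1 = begin
      t                  ≡⟨ ℚ.*-identityʳ t ⟨
      t * 1ℚ             ≤⟨ ℚ.*-monoˡ-≤-nonNeg t {{ℚ.nonNegative 0≤t}} (ℕ→ℚ-mono-≤ {1} {suc m} (ℕ.s≤s ℕ.z≤n)) ⟩
      t * ℕ→ℚ (suc m)    ≡⟨ 1/suc-inverse m ⟩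
      1ℚ                 ∎
      where open ℚ.≤-Reasoning
    0≤1-t : 0ℚ ≤ 1ℚ - t
    0≤1-t = ℚ.≤-trans (ℚ.≤-reflexive (sym (ℚ.+-inverseʳ t))) (ℚ.+-monoˡ-≤ (- t) t≤1)
    coefficients : ∀ t → t + ((1ℚ - t) + 0ℚ) ≡ 1ℚ
    coefficients = solve-∀ ℚ-ring
    padding : ∀ t x → t * x ≡ t * x + ((1ℚ - t) * 0ℚ + 0ℚ)
    padding = solve-∀ ℚ-ring
    total-scaled : total (t • toPoint p) ≡ 1ℚ
    total-scaled = begin
      total (t • toPoint p)      ≡⟨ total≡dot𝟙 (t • toPoint p) ⟩
      dot 𝟙 (t • toPoint p)      ≡⟨ dot-•ʳ 𝟙 t (toPoint p) ⟩
      t * dot 𝟙 (toPoint p)      ≡⟨ cong (t *_) (trans (sym (total≡dot𝟙 (toPoint p))) total≡) ⟩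
      t * ℕ→ℚ (suc m)            ≡⟨ 1/suc-inverse m ⟩
      1ℚ                         ∎
      where open ≡-Reasoning

  homogenise : ∀ {r} (c : Point r) d → (∀ x → InKostkaPolytope x → dot c x ≤ d) →
    ∀ (p : DomPair r) → dot c (toPoint p) ≤ d * total (toPoint p)
  homogenise c d valid p with sumℕ (DomPair.lam p) ℕ.+ sumℕ (DomPair.mu p) in size≡
  ... | zero = ℚ.≤-reflexive (begin
    dot c (toPoint p)     ≡⟨ dot-congʳ c ((λ i → cong ℕ→ℚ (sumℕ≡0⇒ lam (ℕ.m+n≡0⇒m≡0 _ size≡) i))
                                       , (λ i → cong ℕ→ℚ (sumℕ≡0⇒ mu (ℕ.m+n≡0⇒n≡0 (sumℕ lam) size≡) i))) ⟩
    dot c 0ᵥ              ≡⟨ dot-0ʳ c ⟩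
    0ℚ                    ≡⟨ ℚ.*-zeroʳ d ⟨
    d * 0ℚ                ≡⟨ cong (d *_) (trans (total-toPoint p) (cong ℕ→ℚ size≡)) ⟨
    d * total (toPoint p) ∎)
    where
    open ≡-Reasoning
    lam = DomPair.lam p
    mu  = DomPair.mu p
  ... | suc m = begin
    dot c (toPoint p)                     ≡⟨ suc-*-1/suc-* m (dot c (toPoint p)) ⟨
    ℕ→ℚ (suc m) * (t * dot c (toPoint p)) ≡⟨ cong (ℕ→ℚ (suc m) *_) (dot-•ʳ c t (toPoint p)) ⟨
    ℕ→ℚ (suc m) * dot c (t • toPoint p)   ≤⟨ ℚ.*-monoˡ-≤-nonNeg (ℕ→ℚ (suc m)) {{ℕ→ℚ-nonNegative (suc m)}}
                                              (valid (t • toPoint p) (scaled-∈-polytope p m total≡)) ⟩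
    ℕ→ℚ (suc m) * d                       ≡⟨ ℚ.*-comm (ℕ→ℚ (suc m)) d ⟩
    d * ℕ→ℚ (suc m)                       ≡⟨ cong (d *_) total≡ ⟨
    d * total (toPoint p)                 ∎
    where
    open ℚ.≤-Reasoning
    t = 1/suc m
    total≡ : total (toPoint p) ≡ ℕ→ℚ (suc m)
    total≡ = trans (total-toPoint p) (cong ℕ→ℚ size≡)

module ConeCombination where

  open import Data.Nat
  open import Data.Nat.Properties
  open import Data.Product using (_,_)
  open import Data.Sum using (_⊎_)
  import Data.Sum as Sum
  open import Function.Bundles using (Equivalence)
  open import Relation.Nullary using (¬_)
  open import Relation.Binary.PropositionalEquality
  open import Data.Rational as ℚ using (ℚ)
  open import Data.Fin using (toℕ)
  open import Defs using (DomPair; toPoint; ℕ→ℚ; _≈_)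
  open Embedding
  open Sequences
  open Vectors using (_⊕_; _⊖_; _•_)
  open Rays
  open Partitions
  open Vertices
  open Supports
  open Slacks

  -- Since the support of w lies in those of u and v, N (u + v) − w stays in the Kostka cone once N bounds w.
  module Combination {r a b ℓ a′ b′ ℓ′ x y z : ℕ}
    (eu : Extremal (a , b , ℓ)) (a≤r : a ≤ r) (ev : Extremal (a′ , b′ , ℓ′)) (a′≤r : a′ ≤ r)
    (ew : Extremal (x , y , z)) (x≤r : x ≤ r) (w⊆u∪v : (x , y , z) ⊆ (a , b , ℓ) ∪ (a′ , b′ , ℓ′)) where

    N : ℕ
    N = r * x

    private
      u = (a , b , ℓ)
      v = (a′ , b′ , ℓ′)
      w = (x , y , z)

      x≤N : x ≤ N
      x≤N = m≤n*m x r {{>-nonZero (<-≤-trans (extremal-1≤a ew) x≤r)}}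

      slack-covered : ∀ φ → 0 < slack φ (ray w) → 0 < slack φ (ray u) ⊎ 0 < slack φ (ray v)
      slack-covered φ pos = Sum.map (Equivalence.from (slack-ray-positive⇔Support eu φ))
        (Equivalence.from (slack-ray-positive⇔Support ev φ))
        (w⊆u∪v φ (Equivalence.to (slack-ray-positive⇔Support ew φ) pos))

      0<∸⇒< : ∀ {m n} → 0 < m ∸ n → n < m
      0<∸⇒< 0<m∸n = m∸n≢0⇒n<m (>⇒≢ 0<m∸n)

      descλ-covered : ∀ j → rλ w (suc j) < rλ w j → rλ u (suc j) < rλ u j ⊎ rλ v (suc j) < rλ v j
      descλ-covered j drop = Sum.map 0<∸⇒< 0<∸⇒< (slack-covered (descλ j) (m<n⇒0<n∸m drop))

      descμ-covered : ∀ j → rμ w (suc j) < rμ w j → rμ u (suc j) < rμ u j ⊎ rμ v (suc j) < rμ v j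
      descμ-covered j drop = Sum.map 0<∸⇒< 0<∸⇒< (slack-covered (descμ j) (m<n⇒0<n∸m drop))

      dom-covered : ∀ k → Σ< k (rμ w) < Σ< k (rλ w) → Σ< k (rμ u) < Σ< k (rλ u) ⊎ Σ< k (rμ v) < Σ< k (rλ v)
      dom-covered k gap = Sum.map 0<∸⇒< 0<∸⇒< (slack-covered (dom k) (m<n⇒0<n∸m gap))

      Xλ Xμ : ℕ → ℕ
      Xλ n = N * (rλ u n + rλ v n) ∸ rλ w n
      Xμ n = N * (rμ u n + rμ v n) ∸ rμ w n

      rλw≤ : ∀ n → rλ w n ≤ N * (rλ u n + rλ v n)
      rλw≤ = ≤-scaled-sum N (rλ-antitone eu) (rλ-antitone ev) (λ n → ≤-trans (rλ-≤ {x} {y} {z}) x≤N)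
        descλ-covered r (rλ-beyond ew x≤r)

      rμw≤ : ∀ n → rμ w n ≤ N * (rμ u n + rμ v n)
      rμw≤ = ≤-scaled-sum N (rμ-antitone eu) (rμ-antitone ev) (λ n → ≤-trans (rμ-≤ {x} {y} {z} (extremal-b≤a ew)) x≤N)
        descμ-covered r (rμ-beyond ew x≤r)

      Xλ-antitone : Antitone Xλ
      Xλ-antitone j = scaled-sum∸-mono N (rλ-antitone eu j) (rλ-antitone ev j) (≤-trans (rλ-≤ {x} {y} {z}) x≤N)
        (descλ-covered j)

      Xμ-antitone : Antitone Xμ
      Xμ-antitone j = scaled-sum∸-mono N (rμ-antitone eu j) (rμ-antitone ev j)
        (≤-trans (rμ-≤ {x} {y} {z} (extremal-b≤a ew)) x≤N) (descμ-covered j)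

      Σ<-Xλ : ∀ k → Σ< k Xλ ≡ N * (Σ< k (rλ u) + Σ< k (rλ v)) ∸ Σ< k (rλ w)
      Σ<-Xλ k = Σ<-scaled-sum∸ k N (rλ u) (rλ v) (rλ w) rλw≤

      Σ<-Xμ : ∀ k → Σ< k Xμ ≡ N * (Σ< k (rμ u) + Σ< k (rμ v)) ∸ Σ< k (rμ w)
      Σ<-Xμ k = Σ<-scaled-sum∸ k N (rμ u) (rμ v) (rμ w) rμw≤

      X-dominance : ∀ k → k ≤ r → Σ< k Xμ ≤ Σ< k Xλ
      X-dominance k k≤r = subst₂ _≤_ (sym (Σ<-Xμ k)) (sym (Σ<-Xλ k))
        (scaled-sum∸-mono N (Σ<-rμ≤rλ eu k) (Σ<-rμ≤rλ ev k) Σ<rλw≤N (dom-covered k))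
        where
        Σ<rλw≤N : Σ< k (rλ w) ≤ N
        Σ<rλw≤N = ≤-trans (Σ<-≤-* k (λ n → rλ-≤ {x} {y} {z} {n})) (*-monoˡ-≤ x k≤r)

      beyond : ∀ {a b ℓ} → a ≤ r → ¬ Gap (a , b , ℓ) r
      beyond a≤r (_ , r<a , _) = <⇒≱ r<a a≤r

      X-balanced : Σ< r Xμ ≡ Σ< r Xλ
      X-balanced rewrite Σ<-Xμ r | Σ<-Xλ r
                       | Σ<-rμ≡rλ eu r (beyond a≤r) | Σ<-rμ≡rλ ev r (beyond a′≤r) | Σ<-rμ≡rλ ew r (beyond x≤r) = refl

    combination : DomPair r
    combination = fromSequences Xλ Xμ Xλ-antitone Xμ-antitone X-dominance X-balanced

    toPoint-combination :
      toPoint combination ≈ (ℕ→ℚ N • (toPoint (rayPair eu a≤r) ⊕ toPoint (rayPair ev a′≤r)) ⊖ toPoint (rayPair ew x≤r))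
    toPoint-combination = (λ i → cast (rλ u) (rλ v) (rλ w) rλw≤ (toℕ i)) , (λ i → cast (rμ u) (rμ v) (rμ w) rμw≤ (toℕ i))
      where
      cast : ∀ (U V W : ℕ → ℕ) → (∀ n → W n ≤ N * (U n + V n)) → ∀ n →
        ℕ→ℚ (N * (U n + V n) ∸ W n) ≡ ℕ→ℚ N ℚ.* (ℕ→ℚ (U n) ℚ.+ ℕ→ℚ (V n)) ℚ.- ℕ→ℚ (W n)
      cast U V W W≤ n = trans (ℕ→ℚ-homo-∸ (W≤ n))
        (cong (ℚ._- ℕ→ℚ (W n)) (trans (ℕ→ℚ-homo-* N (U n + V n)) (cong (ℕ→ℚ N ℚ.*_) (ℕ→ℚ-homo-+ (U n) (V n)))))

module Edges where

  open import Data.Nat as ℕ using (ℕ; _≤_; _∸_)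
  import Data.Nat.Properties as ℕ
  open import Data.Rational as ℚ using (ℚ; 0ℚ; 1ℚ; -_; _+_; _-_; _*_)
  import Data.Rational.Properties as ℚ
  open import Data.Product using (_×_; _,_; proj₁; proj₂)
  import Data.Sum as Sum
  open import Data.Sum using (_⊎_; inj₁; inj₂)
  open import Function.Bundles using (_⇔_; mk⇔; Equivalence)
  open import Relation.Binary.PropositionalEquality
  open import Relation.Nullary using (¬_; yes; no)
  open import Data.Empty using (⊥; ⊥-elim)
  open import Defs
  open import Tactic.RingSolver using (solve-∀)
  open RationalRing
  open Embedding
  open Vectors
  open Rays
  open Partitions
  open Vertices
  open Supports
  open EdgeConditions
  open Slacks
  open FaceNormals
  open Cone
  open ConeCombination

  ≡⇒≈ : ∀ {r} {x y : Point r} → x ≡ y → x ≈ y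
  ≡⇒≈ refl = ≈-refl

  module FaceOf {r a b ℓ a′ b′ ℓ′ : ℕ} (eu : Extremal (a , b , ℓ)) (ev : Extremal (a′ , b′ , ℓ′)) where

    private
      u = (a , b , ℓ)
      v = (a′ , b′ , ℓ′)
      c : Point r
      c = faceNormal u v

    dot-faceNormal-vertexAt : ∀ {x y z} (ew : Extremal (x , y , z)) (x≤r : x ≤ r) →
      dot c (vertexAt {r} (x , y , z)) ≡ normaliser ew x≤r * - ℕ→ℚ (faceSlack r u v (ray (x , y , z)))
    dot-faceNormal-vertexAt ew x≤r = trans (dot-vertexAt ew x≤r c) (cong (normaliser ew x≤r *_)
      (dot-faceNormal u v (rayPair ew x≤r) _ (slack-cong (extend-∘toℕ (rλ-beyond ew x≤r)) (extend-∘toℕ (rμ-beyond ew x≤r)))))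

    faceNormal-valid : ∀ x → InKostkaPolytope x → dot c x ℚ.≤ 0ℚ
    faceNormal-valid = polytope-≤0 c (λ p → ℚ.≤-trans (ℚ.≤-reflexive (dot-faceNormal u v p (sequences p) (λ _ → refl)))
      (neg-ℕ→ℚ≤0 (faceSlack r u v (sequences p))))

    vertexAt-on-face⇔ : ∀ {x y z} (ew : Extremal (x , y , z)) (x≤r : x ≤ r) →
      dot c (vertexAt {r} (x , y , z)) ≡ 0ℚ ⇔ faceSlack r u v (ray (x , y , z)) ≡ 0
    vertexAt-on-face⇔ {x} {y} {z} ew x≤r = mk⇔ to from
      where
      s = faceSlack r u v (ray (x , y , z))
      n = normaliser ew x≤r
      to : dot c (vertexAt (x , y , z)) ≡ 0ℚ → s ≡ 0
      to on-face = ℕ→ℚ-injective (ℚ.neg-injective (1/suc-cancelˡ (ℕ.pred (size {r} (x , y , z)))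
        (trans (sym (dot-faceNormal-vertexAt ew x≤r)) (trans on-face (sym (ℚ.*-zeroʳ n))))))
      from : s ≡ 0 → dot c (vertexAt (x , y , z)) ≡ 0ℚ
      from s≡0 = trans (dot-faceNormal-vertexAt ew x≤r) (trans (cong (λ m → n * - ℕ→ℚ m) s≡0) (ℚ.*-zeroʳ n))

    module _ (condition : Condition u v) (excess : a ∸ b ≤ a′ ∸ b′) where

      face-vertices : ∀ {x y z} (ew : Extremal (x , y , z)) (x≤r : x ≤ r) →
        dot c (vertexAt {r} (x , y , z)) ≡ 0ℚ ⇔ ((x , y , z) ≡ u ⊎ (x , y , z) ≡ v)
      face-vertices ew x≤r = mk⇔
        (λ on-face → covered⇒endpoint eu ev ew condition excess
          (faceSlack≡0⇒⊆ r u v eu ev ew x≤r (Equivalence.to (vertexAt-on-face⇔ ew x≤r) on-face)))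
        (λ { (inj₁ refl) → Equivalence.from (vertexAt-on-face⇔ ew x≤r) (faceSlack-left r u v)
           ; (inj₂ refl) → Equivalence.from (vertexAt-on-face⇔ ew x≤r) (faceSlack-right r u v) })

      condition⇒edge : a ≤ r → a′ ≤ r → IsEdge (vertexAt {r} u) (vertexAt {r} v)
      condition⇒edge a≤r a′≤r = c , 0ℚ , faceNormal-valid , λ L → on-face⇔endpoint L (label-extremal L)
        where
        on-face⇔endpoint : ∀ L → Extremal (triple L) × Label.a L ≤ r →
          (dot c (vertex L) ≡ 0ℚ) ⇔ (vertex L ≈ vertexAt u ⊎ vertex L ≈ vertexAt v)
        on-face⇔endpoint L (ew , x≤r) = mk⇔
          (λ on-face → Sum.map (λ L≡u → ≡⇒≈ (cong vertexAt L≡u)) (λ L≡v → ≡⇒≈ (cong vertexAt L≡v))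
            (Equivalence.to (face-vertices ew x≤r) on-face))
          λ { (inj₁ L≈u) → trans (dot-congʳ c L≈u) (Equivalence.from (face-vertices eu a≤r) (inj₁ refl))
            ; (inj₂ L≈v) → trans (dot-congʳ c L≈v) (Equivalence.from (face-vertices ev a′≤r) (inj₂ refl)) }

  -- The face normal of (u, u) vanishes at vertexAt w only for w = u.
  vertexAt-injective : ∀ {r x y z a b ℓ} → Extremal (x , y , z) → x ≤ r → Extremal (a , b , ℓ) → a ≤ r →
    vertexAt {r} (x , y , z) ≈ vertexAt {r} (a , b , ℓ) → (x , y , z) ≡ (a , b , ℓ)
  vertexAt-injective {r} {a = a} {b} {ℓ} ew x≤r eu a≤r w≈u = Sum.reduce (Equivalence.to (on-face ew x≤r)
    (trans (dot-congʳ (faceNormal (a , b , ℓ) (a , b , ℓ)) w≈u) (Equivalence.from (on-face eu a≤r) (inj₁ refl))))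
    where
    open FaceOf {r} eu eu
    on-face = face-vertices (condition-refl eu) ℕ.≤-refl

  module ValidInequality {r : ℕ} (c : Point r) (d : ℚ) (valid : ∀ x → InKostkaPolytope x → dot c x ℚ.≤ d) where

    homogenised : Point r
    homogenised = d • 𝟙 ⊖ c

    private
      e = homogenised

    dot-homogenised : ∀ p → dot e p ≡ d * total p - dot c p
    dot-homogenised p =
      trans (dot-⊖ˡ (d • 𝟙) c p) (cong (_- dot c p) (trans (dot-•ˡ d 𝟙 p) (cong (d *_) (sym (total≡dot𝟙 p)))))

    homogenised-nonnegative : ∀ (p : DomPair r) → 0ℚ ℚ.≤ dot e (toPoint p)
    homogenised-nonnegative p = begin
      0ℚ                                    ≡⟨ ℚ.+-inverseʳ (dot c (toPoint p)) ⟨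
      dot c (toPoint p) - dot c (toPoint p) ≤⟨ ℚ.+-monoˡ-≤ (- dot c (toPoint p)) (homogenise c d valid p) ⟩
      d * total (toPoint p) - dot c (toPoint p) ≡⟨ dot-homogenised (toPoint p) ⟨
      dot e (toPoint p)                     ∎
      where open ℚ.≤-Reasoning

    tight⇔homogenised-ray≡0 : ∀ {t₁ t₂ t₃} (et : Extremal (t₁ , t₂ , t₃)) (t≤r : t₁ ≤ r) →
      dot c (vertexAt {r} (t₁ , t₂ , t₃)) ≡ d ⇔ dot e (toPoint (rayPair et t≤r)) ≡ 0ℚ
    tight⇔homogenised-ray≡0 {t₁} {t₂} {t₃} et t≤r = mk⇔
      (λ tight → 1/suc-cancelˡ (ℕ.pred (size {r} t)) (trans dot-e-vertexAt
        (trans (cong (λ q → d * 1ℚ - q) tight) (trans (cancel d) (sym (ℚ.*-zeroʳ n))))))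
      (λ e-ray≡0 → sym (difference≡0 (trans (sym dot-e-vertexAt) (trans (cong (n *_) e-ray≡0) (ℚ.*-zeroʳ n)))))
      where
      t = (t₁ , t₂ , t₃)
      n = normaliser et t≤r
      dot-e-vertexAt : n * dot e (toPoint (rayPair et t≤r)) ≡ d * 1ℚ - dot c (vertexAt t)
      dot-e-vertexAt = trans (sym (dot-vertexAt et t≤r e))
        (trans (dot-homogenised (vertexAt t)) (cong (λ s → d * s - dot c (vertexAt t)) (total-vertexAt et t≤r)))
      cancel : ∀ d → d * 1ℚ - d ≡ 0ℚ
      cancel = solve-∀ ℚ-ring
      split : ∀ x y → x ≡ (x * 1ℚ - y) + y
      split = solve-∀ ℚ-ring
      difference≡0 : ∀ {x y} → x * 1ℚ - y ≡ 0ℚ → x ≡ y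
      difference≡0 {x} {y} eq = trans (split x y) (trans (cong (_+ y) eq) (ℚ.+-identityˡ y))

    -- e vanishes at u and v and is nonnegative at N (u + v) − w, which lies in the cone.
    covered-tight : ∀ {a b ℓ a′ b′ ℓ′ x y z} →
      (eu : Extremal (a , b , ℓ)) (a≤r : a ≤ r) (ev : Extremal (a′ , b′ , ℓ′)) (a′≤r : a′ ≤ r)
      (ew : Extremal (x , y , z)) (x≤r : x ≤ r) → (x , y , z) ⊆ (a , b , ℓ) ∪ (a′ , b′ , ℓ′) →
      dot c (vertexAt (a , b , ℓ)) ≡ d → dot c (vertexAt (a′ , b′ , ℓ′)) ≡ d → dot c (vertexAt (x , y , z)) ≡ d
    covered-tight eu a≤r ev a′≤r ew x≤r w⊆u∪v u-tight v-tight =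
      Equivalence.from (tight⇔homogenised-ray≡0 ew x≤r) (ℚ.≤-antisym e-ŵ≤0 (homogenised-nonnegative (rayPair ew x≤r)))
      where
      open Combination eu a≤r ev a′≤r ew x≤r w⊆u∪v using (N; combination; toPoint-combination)
      û = toPoint (rayPair eu a≤r)
      v̂ = toPoint (rayPair ev a′≤r)
      ŵ = toPoint (rayPair ew x≤r)

      e-combination : dot e (toPoint combination) ≡ - dot e ŵ
      e-combination = begin
        dot e (toPoint combination)                 ≡⟨ dot-congʳ e toPoint-combination ⟩
        dot e (ℕ→ℚ N • (û ⊕ v̂) ⊖ ŵ)                ≡⟨ dot-⊖ʳ e (ℕ→ℚ N • (û ⊕ v̂)) ŵ ⟩
        dot e (ℕ→ℚ N • (û ⊕ v̂)) - dot e ŵ          ≡⟨ cong (_- dot e ŵ) (dot-•ʳ e (ℕ→ℚ N) (û ⊕ v̂)) ⟩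
        ℕ→ℚ N * dot e (û ⊕ v̂) - dot e ŵ            ≡⟨ cong (λ q → ℕ→ℚ N * q - dot e ŵ) (dot-⊕ʳ e û v̂) ⟩
        ℕ→ℚ N * (dot e û + dot e v̂) - dot e ŵ      ≡⟨ cong₂ (λ p q → ℕ→ℚ N * (p + q) - dot e ŵ) e-û≡0 e-v̂≡0 ⟩
        ℕ→ℚ N * (0ℚ + 0ℚ) - dot e ŵ                ≡⟨ vanish (ℕ→ℚ N) (dot e ŵ) ⟩
        - dot e ŵ                                    ∎
        where
        open ≡-Reasoning
        e-û≡0 = Equivalence.to (tight⇔homogenised-ray≡0 eu a≤r) u-tight
        e-v̂≡0 = Equivalence.to (tight⇔homogenised-ray≡0 ev a′≤r) v-tight
        vanish : ∀ n q → n * (0ℚ + 0ℚ) - q ≡ - q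
        vanish = solve-∀ ℚ-ring

      e-ŵ≤0 : dot e ŵ ℚ.≤ 0ℚ
      e-ŵ≤0 = begin
        dot e ŵ          ≡⟨ neg-involutive (dot e ŵ) ⟩
        - (- dot e ŵ)    ≤⟨ ℚ.neg-antimono-≤ (subst (0ℚ ℚ.≤_) e-combination (homogenised-nonnegative combination)) ⟩
        - 0ℚ             ≡⟨⟩
        0ℚ               ∎
        where
        open ℚ.≤-Reasoning
        neg-involutive : ∀ q → q ≡ - (- q)
        neg-involutive = solve-∀ ℚ-ring

  module _ {r a b ℓ a′ b′ ℓ′ : ℕ} (eu : Extremal (a , b , ℓ)) (a≤r : a ≤ r) (ev : Extremal (a′ , b′ , ℓ′)) (a′≤r : a′ ≤ r)
    (excess : a ∸ b ≤ a′ ∸ b′) where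

    private
      u = (a , b , ℓ)
      v = (a′ , b′ , ℓ′)

    ¬condition⇒¬edge : ¬ Condition u v → ¬ IsEdge (vertexAt {r} u) (vertexAt {r} v)
    ¬condition⇒¬edge ¬condition (c , d , valid , tight⇔endpoint) =
      w-not-endpoint (Equivalence.to (tight⇔endpoint Lw) w-tight)
      where
      open Witness (¬condition⇒witness eu ev ¬condition excess)
      open ValidInequality c d valid
      x≤r = covered-a≤ extremal eu ev a≤r a′≤r covered
      Lw = proj₁ (labelOf extremal x≤r)
      triple-Lw = proj₂ (labelOf extremal x≤r)

      endpoint-tight : ∀ {t₁ t₂ t₃} → Extremal (t₁ , t₂ , t₃) → t₁ ≤ r →
        vertexAt (t₁ , t₂ , t₃) ≈ vertexAt u ⊎ vertexAt (t₁ , t₂ , t₃) ≈ vertexAt v →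
        dot c (vertexAt {r} (t₁ , t₂ , t₃)) ≡ d
      endpoint-tight et t≤r endpoint with labelOf et t≤r
      ... | L , refl = Equivalence.from (tight⇔endpoint L) endpoint

      w-tight : dot c (vertex Lw) ≡ d
      w-tight = subst (λ t → dot c (vertexAt t) ≡ d) (sym triple-Lw)
        (covered-tight eu a≤r ev a′≤r extremal x≤r covered
          (endpoint-tight eu a≤r (inj₁ ≈-refl)) (endpoint-tight ev a′≤r (inj₂ ≈-refl)))

      eLw = proj₁ (label-extremal Lw)
      Lw≤r = proj₂ (label-extremal Lw)

      w-not-endpoint : vertex Lw ≈ vertexAt u ⊎ vertex Lw ≈ vertexAt v → ⊥
      w-not-endpoint (inj₁ w≈u) = ≢-left (trans (sym triple-Lw) (vertexAt-injective eLw Lw≤r eu a≤r w≈u))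
      w-not-endpoint (inj₂ w≈v) = ≢-right (trans (sym triple-Lw) (vertexAt-injective eLw Lw≤r ev a′≤r w≈v))

    edge⇔condition : IsEdge (vertexAt {r} u) (vertexAt {r} v) ⇔ Condition u v
    edge⇔condition = mk⇔ edge⇒condition (λ condition → FaceOf.condition⇒edge eu ev condition excess a≤r a′≤r)
      where
      edge⇒condition : IsEdge (vertexAt u) (vertexAt v) → Condition u v
      edge⇒condition edge with condition? u v
      ... | yes condition = condition
      ... | no ¬condition = ⊥-elim (¬condition⇒¬edge ¬condition edge)

open import Defs
open import Data.Nat using (ℕ; _≤_; _∸_)
open import Relation.Nullary using (¬_)
open import Function.Bundles using (_⇔_)
open import Data.Product using (_,_)
open import Function.Bundles using (mk⇔; Equivalence)
open import Relation.Binary.PropositionalEquality using (sym)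
open import Function.Base using (_∘_)
open Rays using (extremal-b≤a)
open Vertices using (label-extremal; rayℓ-off-diagonal)
open EdgeConditions using (Condition-respects-ℓ)
open Edges using (edge⇔condition)

theorem4p5 : (r : ℕ) → 1 ≤ r → (L L' : Label r) →
    ¬ (vertex L ≈ vertex L') →
    Label.a L ∸ Label.b L ≤ Label.a L' ∸ Label.b L' →
    IsEdge (vertex L) (vertex L') ⇔ EdgeCondition L L'
theorem4p5 r _ L L′ _ excess with label-extremal L | label-extremal L′
... | eu , a≤r | ev , a′≤r = mk⇔
  (λ edge → Condition-respects-ℓ b≤a (rayℓ-off-diagonal L) (rayℓ-off-diagonal L′) excess (Equivalence.to edge⇔ edge))
  (λ condition → Equivalence.from edge⇔
    (Condition-respects-ℓ b≤a (sym ∘ rayℓ-off-diagonal L) (sym ∘ rayℓ-off-diagonal L′) excess condition))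
  where
  edge⇔ = edge⇔condition eu a≤r ev a′≤r excess
  b≤a = extremal-b≤a eu
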